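{- Let $G$ be a distance hereditary graph with at least two vertices, and suppose that exactly $n$ true twins are added in some construction sequence of $G$. Then $\gamma(G)=2^{n+1}$.
   Context: For a finite simple graph $G$, $q_N(G;x)=\sum_{W\subseteq V(G)}(x-1)^{n(G[W])}$, where $n(G[W])$ is the $\mathbb{F}_2$-nullity of the adjacency matrix of the induced subgraph $G[W]$ (empty set contributing $1$); $\gamma(G)$ is the coefficient of $x^1$ in $q_N(G;x)$. A distance hereditary (DH) graph is a graph constructible from a single vertex by finitely many operations: (1) adding a pendant vertex to a vertex $v$ (new vertex $v'$ and edge $vv'$); (2a) adding a true twin of a non-isolated vertex $v$ (new vertex $v'$ adjacent to $v$ and exactly to the neighbors of $v$); (2b) adding a false twin of a non-isolated vertex $v$ (new vertex $v'$ adjacent exactly to the neighbors of $v$, not to $v$). Such a sequence of operations is a construction sequence. -}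

module Defs where

open import Data.Nat using (ℕ; zero; suc)
open import Data.Nat.Logarithm using (⌊log₂_⌋)
open import Data.Bool using (Bool; true; false; _∧_; _∨_; _xor_; not; if_then_else_)
open import Data.Fin using (Fin; zero; suc; _≟_)
open import Data.Vec using (Vec; []; _∷_)
open import Data.List using (List; []; _∷_; map; foldr; length; lookup; filter; _++_; concatMap)
import Data.List as L
open import Data.Integer using (ℤ; +_; -[1+_]; _+_; _*_; -_)
open import Data.Product using (Σ; ∃; _×_; _,_)
open import Relation.Binary.PropositionalEquality using (_≡_; refl)
open import Relation.Nullary.Decidable using (⌊_⌋)
open import Function.Bundles using (_↔_; Inverse)

record Graph (n : ℕ) : Set where
  field
    adj   : Fin n → Fin n → Bool
    sym   : ∀ i j → adj i j ≡ adj j i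
    irrefl : ∀ i → adj i i ≡ false
open Graph public

_≅_ : ∀ {n} → Graph n → Graph n → Set
_≅_ {n} G H = Σ (Fin n ↔ Fin n) λ f →
  ∀ i j → adj G (Inverse.to f i) (Inverse.to f j) ≡ adj H i j

-- Linear algebra over F₂ (Bool with xor as +, ∧ as ·)

allVecs : (m : ℕ) → List (Vec Bool m)
allVecs zero = [] ∷ []
allVecs (suc m) = map (false ∷_) (allVecs m) ++ map (true ∷_) (allVecs m)

lookupV : ∀ {m} → Vec Bool m → Fin m → Bool
lookupV (b ∷ _) zero = b
lookupV (_ ∷ v) (suc i) = lookupV v i

allFinL : (m : ℕ) → List (Fin m)
allFinL zero = []
allFinL (suc m) = zero ∷ map suc (allFinL m)

mulRow : ∀ {m} → (Fin m → Fin m → Bool) → Vec Bool m → Fin m → Bool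
mulRow {m} M x i = foldr (λ j acc → (M i j ∧ lookupV x j) xor acc) false (allFinL m)

inKernel : ∀ {m} → (Fin m → Fin m → Bool) → Vec Bool m → Bool
inKernel {m} M x = foldr (λ i acc → not (mulRow M x i) ∧ acc) true (allFinL m)

kernelSize : ∀ {m} → (Fin m → Fin m → Bool) → ℕ
kernelSize {m} M = length (L.filter (λ x → Data.Bool._≟_ (inKernel M x) true) (allVecs m))

-- F₂-nullity = dim ker M = log₂ |ker M|  (|ker M| = 2^(dim ker M) over F₂)
nullity : ∀ {m} → (Fin m → Fin m → Bool) → ℕ
nullity M = ⌊log₂ kernelSize M ⌋

-- Induced subgraphs: W ⊆ V(G) given by a characteristic vector; the
-- adjacency matrix of G[W] with vertices W listed in increasing order.

members : ∀ {n} → Vec Bool n → List (Fin n)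
members {n} W = L.filter (λ i → Data.Bool._≟_ (lookupV W i) true) (allFinL n)

inducedAdj : ∀ {n} (G : Graph n) (W : Vec Bool n) →
  Fin (length (members W)) → Fin (length (members W)) → Bool
inducedAdj G W i j = adj G (lookup (members W) i) (lookup (members W) j)

nullityInduced : ∀ {n} → Graph n → Vec Bool n → ℕ
nullityInduced G W = nullity (inducedAdj G W)

-- Integer polynomials as coefficient lists (index k = coefficient of x^k)

Poly : Set
Poly = List ℤ

_⊕_ : Poly → Poly → Poly
[] ⊕ q = q
(a ∷ p) ⊕ [] = a ∷ p
(a ∷ p) ⊕ (b ∷ q) = (a + b) ∷ (p ⊕ q)

scale : ℤ → Poly → Poly
scale c = map (c *_)

_⊗_ : Poly → Poly → Poly
[] ⊗ q = []
(a ∷ p) ⊗ q = scale a q ⊕ (+ 0 ∷ (p ⊗ q))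

xMinus1 : Poly
xMinus1 = -[1+ 0 ] ∷ + 1 ∷ []

_^ᴾ_ : Poly → ℕ → Poly
p ^ᴾ zero = + 1 ∷ []
p ^ᴾ suc k = p ⊗ (p ^ᴾ k)

coeff : Poly → ℕ → ℤ
coeff [] _ = + 0
coeff (a ∷ p) zero = a
coeff (a ∷ p) (suc k) = coeff p k

-- q_N(G;x) = Σ_{W ⊆ V(G)} (x-1)^{n(G[W])}   (empty W: nullity 0, term 1)
qN : ∀ {n} → Graph n → Poly
qN {n} G = foldr (λ W acc → (xMinus1 ^ᴾ nullityInduced G W) ⊕ acc) [] (allVecs n)

γ : ∀ {n} → Graph n → ℤ
γ G = coeff (qN G) 1

-- Distance hereditary construction sequences.
-- A new vertex is added as vertex 0; old vertex i becomes suc i.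

extend : ∀ {n} → Graph n → (N : Fin n → Bool) → Graph (suc n)
extend {n} G N = record { adj = a ; sym = s ; irrefl = r }
  where
  a : Fin (suc n) → Fin (suc n) → Bool
  a zero zero = false
  a zero (suc j) = N j
  a (suc i) zero = N i
  a (suc i) (suc j) = adj G i j
  s : ∀ i j → a i j ≡ a j i
  s zero zero = refl
  s zero (suc j) = refl
  s (suc i) zero = refl
  s (suc i) (suc j) = sym G i j
  r : ∀ i → a i i ≡ false
  r zero = refl
  r (suc i) = irrefl G i

K₁ : Graph 1
K₁ = record { adj = λ _ _ → false ; sym = λ _ _ → refl ; irrefl = λ _ → refl }

NonIsolated : ∀ {n} → Graph n → Fin n → Set
NonIsolated G v = ∃ λ w → adj G v w ≡ true

pendantN : ∀ {n} → Fin n → Fin n → Bool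
pendantN v j = ⌊ j ≟ v ⌋

trueTwinN : ∀ {n} → Graph n → Fin n → Fin n → Bool
trueTwinN G v j = adj G v j ∨ ⌊ j ≟ v ⌋

falseTwinN : ∀ {n} → Graph n → Fin n → Fin n → Bool
falseTwinN G v j = adj G v j

data DHSeq : (n : ℕ) → Graph n → ℕ → Set where
  single    : DHSeq 1 K₁ 0
  pendant   : ∀ {n G t} → DHSeq n G t → (v : Fin n) →
              DHSeq (suc n) (extend G (pendantN v)) t
  trueTwin  : ∀ {n G t} → DHSeq n G t → (v : Fin n) → NonIsolated G v →
              DHSeq (suc n) (extend G (trueTwinN G v)) (suc t)
  falseTwin : ∀ {n G t} → DHSeq n G t → (v : Fin n) → NonIsolated G v →
              DHSeq (suc n) (extend G (falseTwinN G v)) t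

-- Write K(W) for the size of the kernel over F₂ of the adjacency matrix of G[W], so that
-- γ(G) = Σ_W c₁(log₂ K(W)) with c₁(k) = [x¹](x - 1)ᵏ, and c₁(k) + c₁(k + 1) = (-1)ᵏ.
-- Pivoting on an edge of G[W] (a Schur complement over F₂) and splitting off isolated vertices
-- of G[W] show that K(W) = 2ᵏ with k ≡ |W| (mod 2). Let G′ arise from G by adding v′ along v.
-- For a true twin, n(G′[W + v′]) = n(G[W △ {v}]), so γ doubles. For a pendant or a false twin,
-- the sets W + v′ and (W △ {v}) + v′ have nullities k + 1 and k, where k = n(G[W]) and W is the
-- member of the pair on the appropriate side of v; so the new terms add up to the alternating
-- sum Σ (-1)^|W| over the subsets W on one side of v, which vanishes as soon as G has a second
-- vertex. Since γ(K₂) = 2, γ = 2^(t + 1) follows by induction along the construction sequence.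

module Submission where

open import Defs hiding (sym)
open import Data.Nat using (ℕ; _≤_; _+_; _^_)
open import Data.Integer using (ℤ; +_)
open import Relation.Binary.PropositionalEquality using (_≡_)

import Algebra.Properties.CommutativeSemigroup as CommSemigroupProperties
open import Algebra.Bundles using (CommutativeRing)
open import Data.Bool using (Bool; true; false; _∧_; _∨_; _xor_; not; if_then_else_)
import Data.Bool as Bool
import Data.Bool.Properties as BoolP
open import Data.Fin using (Fin; zero; suc)
open import Data.Fin.Permutation using (↔⇒≡)
import Data.Fin.Properties as FinP
open import Data.Integer using (-[1+_])
import Data.Integer as ℤ
import Data.Integer.Properties as ℤP
open import Data.List using (List; []; _∷_; map; foldr; length; lookup; filter; _++_)
import Data.List.Properties as ListP
open import Data.List.Membership.Propositional using (_∈_)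
open import Data.List.Membership.Propositional.Properties
  using (∈-map⁺; ∈-map⁻; ∈-filter⁺; ∈-filter⁻; ∈-lookup; ∈-++⁺ˡ; ∈-++⁺ʳ)
open import Data.List.Membership.Propositional.Properties.WithK using (unique∧set⇒bag)
open import Data.List.Relation.Binary.BagAndSetEquality using (∼bag⇒↭)
open import Data.List.Relation.Binary.Disjoint.Propositional using (Disjoint)
open import Data.List.Relation.Binary.Permutation.Propositional using (_↭_; ↭⇒↭ₛ)
import Data.List.Relation.Binary.Permutation.Propositional as Perm
import Data.List.Relation.Binary.Permutation.Propositional.Properties as PermP
import Data.List.Relation.Binary.Permutation.Setoid.Properties as PermₛP
import Data.List.Relation.Unary.All as All
open import Data.List.Relation.Unary.AllPairs using ([]; _∷_)
open import Data.List.Relation.Unary.Any using (here; there; index)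
open import Data.List.Relation.Unary.Any.Properties using (lookup-index)
open import Data.List.Relation.Unary.Unique.Propositional using (Unique)
import Data.List.Relation.Unary.Unique.Propositional.Properties as UniqueP
open import Data.Nat using (zero; suc; _*_; z≤n; s≤s; s≤s⁻¹)
open import Data.Nat.Logarithm using (⌊log₂_⌋; ⌊log₂[2^n]⌋≡n)
import Data.Nat.Properties as ℕP
open import Data.Product using (Σ; ∃; _×_; _,_; proj₁; proj₂)
open import Data.Sum using (_⊎_; inj₁; inj₂)
open import Data.Sum.Function.Propositional using (_⊎-↔_)
open import Data.Unit using (tt)
open import Data.Vec using (Vec; []; _∷_; head; tail; tabulate; replicate)
import Data.Vec.Properties as VecP
open import Function using (_∘_; _↔_; Inverse; mk↔ₛ′; mk⇔)
open import Function.Properties.Inverse using (↔-refl; ↔-trans; ↔-sym)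
open import Level using (0ℓ)
open import Relation.Binary.PropositionalEquality
  using (refl; sym; trans; cong; cong₂; subst; subst₂; _≢_; _≗_; setoid; module ≡-Reasoning)
open import Relation.Nullary using (Dec; yes; no; does; contradiction)
open import Relation.Nullary.Decidable using (⌊_⌋; isYes≗does; True; toWitness; fromWitness; map′; _×-dec_; _→-dec_)
open import Relation.Unary using (Pred; Decidable)

private
  variable
    m n k : ℕ
    A B : Set


-- Linear algebra over F₂

Matrix : ℕ → Set
Matrix n = Fin n → Fin n → Bool

_∋_ _∌_ : Vec Bool n → Fin n → Set
W ∋ i = lookupV W i ≡ true
W ∌ i = lookupV W i ≡ false

_∋?_ : (W : Vec Bool n) (i : Fin n) → Dec (W ∋ i)
W ∋? i = lookupV W i Bool.≟ true

module Xor = CommSemigroupProperties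
  (CommutativeRing.+-commutativeSemigroup BoolP.xor-∧-commutativeRing)

xor-cancelʳ : ∀ a b → (a xor b) xor b ≡ a
xor-cancelʳ a b = begin
  (a xor b) xor b  ≡⟨ BoolP.xor-assoc a b b ⟩
  a xor (b xor b)  ≡⟨ cong (a xor_) (BoolP.xor-same b) ⟩
  a xor false      ≡⟨ BoolP.xor-identityʳ a ⟩
  a                ∎
  where open ≡-Reasoning

xor≡false⇒≡ : ∀ {a b} → a xor b ≡ false → a ≡ b
xor≡false⇒≡ {false} {false} _ = refl
xor≡false⇒≡ {true}  {true}  _ = refl

∌⇒≢ : ∀ {W : Vec Bool n} {i j} → W ∌ i → W ∋ j → j ≢ i
∌⇒≢ i∉W j∈W refl with () ← trans (sym j∈W) i∉W

-- Unlike ⌊ i ≟ j ⌋ (the form used in Defs), does (i ≟ j) reduces on zero and suc.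
δ : Fin n → Fin n → Bool
δ i j = does (i FinP.≟ j)

δ-refl : (i : Fin n) → δ i i ≡ true
δ-refl i with i FinP.≟ i
... | yes _   = refl
... | no i≢i = contradiction refl i≢i

δ-≢ : {i j : Fin n} → i ≢ j → δ i j ≡ false
δ-≢ {i = i} {j} i≢j with i FinP.≟ j
... | yes i≡j = contradiction i≡j i≢j
... | no _    = refl

δ-sym : (i j : Fin n) → δ i j ≡ δ j i
δ-sym i j with i FinP.≟ j
... | yes refl = sym (δ-refl i)
... | no i≢j   = sym (δ-≢ (i≢j ∘ sym))

⌊≟⌋-refl : (v : Fin n) → ⌊ v FinP.≟ v ⌋ ≡ true
⌊≟⌋-refl v = trans (isYes≗does (v FinP.≟ v)) (δ-refl v)

⌊≟⌋-≢ : {l v : Fin n} → l ≢ v → ⌊ l FinP.≟ v ⌋ ≡ false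
⌊≟⌋-≢ {l = l} {v} l≢v = trans (isYes≗does (l FinP.≟ v)) (δ-≢ l≢v)

-- Shaped so that mulRow M x i is xorSum (allFinL n) (λ j → M i j ∧ lookupV x j) by definition.
xorSum : List (Fin n) → (Fin n → Bool) → Bool
xorSum js f = foldr (λ j acc → f j xor acc) false js

xorSum-map : (g : Fin k → Fin n) (js : List (Fin k)) (f : Fin n → Bool) →
             xorSum (map g js) f ≡ xorSum js (f ∘ g)
xorSum-map g []       f = refl
xorSum-map g (j ∷ js) f = cong (f (g j) xor_) (xorSum-map g js f)

xorSum-cong : (js : List (Fin n)) {f g : Fin n → Bool} → f ≗ g → xorSum js f ≡ xorSum js g
xorSum-cong []       f≗g = refl
xorSum-cong (j ∷ js) f≗g = cong₂ _xor_ (f≗g j) (xorSum-cong js f≗g)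

xorSum-xor : (js : List (Fin n)) (f g : Fin n → Bool) →
             xorSum js (λ j → f j xor g j) ≡ xorSum js f xor xorSum js g
xorSum-xor []       f g = refl
xorSum-xor (j ∷ js) f g = trans (cong ((f j xor g j) xor_) (xorSum-xor js f g))
                                (Xor.interchange (f j) (g j) (xorSum js f) (xorSum js g))

xorSum-zero : (js : List (Fin n)) {f : Fin n → Bool} → (∀ j → f j ≡ false) → xorSum js f ≡ false
xorSum-zero []       f≡0 = refl
xorSum-zero (j ∷ js) f≡0 = cong₂ _xor_ (f≡0 j) (xorSum-zero js f≡0)

xorSum-∧ˡ : (js : List (Fin n)) (c : Bool) (f : Fin n → Bool) →
            xorSum js (λ j → c ∧ f j) ≡ c ∧ xorSum js f
xorSum-∧ˡ js true  f = refl
xorSum-∧ˡ js false f = xorSum-zero js (λ _ → refl)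

xorSum-allFinL-suc : (f : Fin (suc n) → Bool) →
                     xorSum (allFinL (suc n)) f ≡ f zero xor xorSum (allFinL n) (f ∘ suc)
xorSum-allFinL-suc {n} f = cong (f zero xor_) (xorSum-map suc (allFinL n) f)

xorSum-δ : (i : Fin n) (c : Bool) → xorSum (allFinL n) (λ j → δ j i ∧ c) ≡ c
xorSum-δ {suc n} zero c = begin
  xorSum (allFinL (suc n)) (λ j → δ j zero ∧ c)  ≡⟨ xorSum-allFinL-suc {n} (λ j → δ j zero ∧ c) ⟩
  c xor xorSum (allFinL n) (λ _ → false)         ≡⟨ cong (c xor_) (xorSum-zero (allFinL n) (λ _ → refl)) ⟩
  c xor false                                    ≡⟨ BoolP.xor-identityʳ c ⟩
  c                                              ∎
  where open ≡-Reasoning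
xorSum-δ {suc n} (suc i) c = trans (xorSum-allFinL-suc (λ j → δ j (suc i) ∧ c)) (xorSum-δ i c)

xorSum-δ′ : (i : Fin n) (c : Bool) → xorSum (allFinL n) (λ j → δ i j ∧ c) ≡ c
xorSum-δ′ i c = trans (xorSum-cong (allFinL _) (λ j → cong (_∧ c) (δ-sym i j))) (xorSum-δ i c)

lookupV-tabulate : (f : Fin n → Bool) (i : Fin n) → lookupV (tabulate f) i ≡ f i
lookupV-tabulate f zero    = refl
lookupV-tabulate f (suc i) = lookupV-tabulate (f ∘ suc) i

lookupV-injective : {u v : Vec Bool n} → (∀ i → lookupV u i ≡ lookupV v i) → u ≡ v
lookupV-injective {u = []}    {[]}    _   = refl
lookupV-injective {u = a ∷ u} {b ∷ v} u≗v = cong₂ _∷_ (u≗v zero) (lookupV-injective (u≗v ∘ suc))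

addAt : Vec Bool n → Fin n → Bool → Vec Bool n
addAt (a ∷ x) zero    b = (a xor b) ∷ x
addAt (a ∷ x) (suc v) b = a ∷ addAt x v b

toggle : Vec Bool n → Fin n → Vec Bool n
toggle W v = addAt W v true

lookupV-addAt-≡ : (x : Vec Bool n) (v : Fin n) (b : Bool) → lookupV (addAt x v b) v ≡ lookupV x v xor b
lookupV-addAt-≡ (a ∷ x) zero    b = refl
lookupV-addAt-≡ (a ∷ x) (suc v) b = lookupV-addAt-≡ x v b

lookupV-addAt-≢ : (x : Vec Bool n) {v l : Fin n} (b : Bool) → v ≢ l → lookupV (addAt x v b) l ≡ lookupV x l
lookupV-addAt-≢ (a ∷ x) {zero}  {zero}  b v≢l = contradiction refl v≢l
lookupV-addAt-≢ (a ∷ x) {zero}  {suc l} b v≢l = refl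
lookupV-addAt-≢ (a ∷ x) {suc v} {zero}  b v≢l = refl
lookupV-addAt-≢ (a ∷ x) {suc v} {suc l} b v≢l = lookupV-addAt-≢ x b (v≢l ∘ cong suc)

addAt-involutive : (x : Vec Bool n) (v : Fin n) (b : Bool) → addAt (addAt x v b) v b ≡ x
addAt-involutive (a ∷ x) zero    b = cong (_∷ x) (xor-cancelʳ a b)
addAt-involutive (a ∷ x) (suc v) b = cong (a ∷_) (addAt-involutive x v b)

addAt-comm : (x : Vec Bool n) (u v : Fin n) (a b : Bool) →
             addAt (addAt x u a) v b ≡ addAt (addAt x v b) u a
addAt-comm (c ∷ x) zero    zero    a b = cong (_∷ x) (Xor.xy∙z≈xz∙y c a b)
addAt-comm (c ∷ x) zero    (suc v) a b = refl
addAt-comm (c ∷ x) (suc u) zero    a b = refl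
addAt-comm (c ∷ x) (suc u) (suc v) a b = cong (c ∷_) (addAt-comm x u v a b)

addAt₂ : Vec Bool n → Fin n → Bool → Fin n → Bool → Vec Bool n
addAt₂ x i a j b = addAt (addAt x i a) j b

addAt₂-involutive : (x : Vec Bool n) (i : Fin n) (a : Bool) (j : Fin n) (b : Bool) →
                    addAt₂ (addAt₂ x i a j b) i a j b ≡ x
addAt₂-involutive x i a j b = begin
  addAt (addAt (addAt (addAt x i a) j b) i a) j b
    ≡⟨ cong (λ y → addAt y j b) (addAt-comm (addAt x i a) j i b a) ⟩
  addAt (addAt (addAt (addAt x i a) i a) j b) j b
    ≡⟨ cong (λ y → addAt (addAt y j b) j b) (addAt-involutive x i a) ⟩
  addAt (addAt x j b) j b
    ≡⟨ addAt-involutive x j b ⟩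
  x
    ∎
  where open ≡-Reasoning

lookupV-toggle-≡ : (W : Vec Bool n) (i : Fin n) → lookupV (toggle W i) i ≡ not (lookupV W i)
lookupV-toggle-≡ W i = trans (lookupV-addAt-≡ W i true) (BoolP.xor-comm (lookupV W i) true)

lookupV-toggle-≢ : (W : Vec Bool n) {i l : Fin n} → i ≢ l → lookupV (toggle W i) l ≡ lookupV W l
lookupV-toggle-≢ W = lookupV-addAt-≢ W true

toggle-∌ : (W : Vec Bool n) {i : Fin n} → W ∋ i → toggle W i ∌ i
toggle-∌ W {i} i∈W = trans (lookupV-toggle-≡ W i) (cong not i∈W)

toggle-∋ : (W : Vec Bool n) {i : Fin n} → W ∌ i → toggle W i ∋ i
toggle-∋ W {i} i∉W = trans (lookupV-toggle-≡ W i) (cong not i∉W)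

toggle-∋⇒≢ : (W : Vec Bool n) {i l : Fin n} → W ∋ i → toggle W i ∋ l → i ≢ l
toggle-∋⇒≢ W i∈W l∈W′ refl with () ← trans (sym l∈W′) (toggle-∌ W i∈W)

toggle-∋⇒∋ : (W : Vec Bool n) {i l : Fin n} → W ∋ i → toggle W i ∋ l → W ∋ l
toggle-∋⇒∋ W i∈W l∈W′ = trans (sym (lookupV-toggle-≢ W (toggle-∋⇒≢ W i∈W l∈W′))) l∈W′

lookupV-addAt-∌ : (x : Vec Bool n) {v : Fin n} (b : Bool) → x ∌ v → lookupV (addAt x v b) v ≡ b
lookupV-addAt-∌ x {v} b x∌v = trans (lookupV-addAt-≡ x v b) (cong (_xor b) x∌v)

module _ (x : Vec Bool n) {i j : Fin n} (a b : Bool) (i≢j : i ≢ j) where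

  lookupV-addAt₂-₁ : lookupV (addAt₂ x i a j b) i ≡ lookupV x i xor a
  lookupV-addAt₂-₁ = trans (lookupV-addAt-≢ (addAt x i a) b (i≢j ∘ sym)) (lookupV-addAt-≡ x i a)

  lookupV-addAt₂-₂ : lookupV (addAt₂ x i a j b) j ≡ lookupV x j xor b
  lookupV-addAt₂-₂ = trans (lookupV-addAt-≡ (addAt x i a) j b) (cong (_xor b) (lookupV-addAt-≢ x a i≢j))

lookupV-addAt₂-≢ : (x : Vec Bool n) {i j l : Fin n} (a b : Bool) → i ≢ l → j ≢ l →
                   lookupV (addAt₂ x i a j b) l ≡ lookupV x l
lookupV-addAt₂-≢ x a b i≢l j≢l = trans (lookupV-addAt-≢ (addAt x _ a) b j≢l) (lookupV-addAt-≢ x a i≢l)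

addAt₂-swap-involutive : (x : Vec Bool n) (i : Fin n) (a : Bool) (j : Fin n) (b : Bool) →
                         addAt₂ (addAt₂ x i a j b) j b i a ≡ x
addAt₂-swap-involutive x i a j b =
  trans (cong (λ y → addAt y i a) (addAt-involutive (addAt x i a) j b)) (addAt-involutive x i a)

move : Fin n → Fin n → Vec Bool n → Vec Bool n
move p q x = addAt₂ x p (lookupV x p) q (lookupV x p)

move-move : (x : Vec Bool n) {p q : Fin n} → p ≢ q → x ∌ q → move q p (move p q x) ≡ x
move-move x {p} {q} p≢q x∌q =
  trans (cong (λ c → addAt₂ (move p q x) q c p c) moved) (addAt₂-swap-involutive x p a q a)
  where
  a = lookupV x p
  moved : lookupV (move p q x) q ≡ a
  moved = trans (lookupV-addAt₂-₂ x a a p≢q) (cong (_xor a) x∌q)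

toggle₂-swap-involutive : (W : Vec Bool n) (u v : Fin n) → toggle (toggle (toggle (toggle W u) v) v) u ≡ W
toggle₂-swap-involutive W u v = addAt₂-swap-involutive W u true v true


filter-map : {P : Pred B 0ℓ} (P? : Decidable P) (f : A → B) (xs : List A) →
             filter P? (map f xs) ≡ map f (filter (P? ∘ f) xs)
filter-map P? f []       = refl
filter-map P? f (x ∷ xs) with P? (f x)
... | yes _ = cong (f x ∷_) (filter-map P? f xs)
... | no  _ = filter-map P? f xs

∈-allFinL : (i : Fin m) → i ∈ allFinL m
∈-allFinL zero    = here refl
∈-allFinL (suc i) = there (∈-map⁺ suc (∈-allFinL i))

allFinL-unique : ∀ m → Unique (allFinL m)
allFinL-unique zero    = []
allFinL-unique (suc m) = All.tabulate zero∉ ∷ UniqueP.map⁺ FinP.suc-injective (allFinL-unique m)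
  where
  zero∉ : ∀ {i} → i ∈ map suc (allFinL m) → zero ≢ i
  zero∉ i∈ refl with _ , _ , () ← ∈-map⁻ suc i∈

lookup-injective : {xs : List A} → Unique xs → ∀ a b → lookup xs a ≡ lookup xs b → a ≡ b
lookup-injective (_   ∷ _) zero    zero    _  = refl
lookup-injective (x∉ ∷ _) zero    (suc b) eq = contradiction eq (All.lookup x∉ (∈-lookup b))
lookup-injective (x∉ ∷ _) (suc a) zero    eq = contradiction (sym eq) (All.lookup x∉ (∈-lookup a))
lookup-injective (_   ∷ u) (suc a) (suc b) eq = cong suc (lookup-injective u a b eq)

map-lookup-allFinL : (xs : List A) → map (lookup xs) (allFinL (length xs)) ≡ xs
map-lookup-allFinL []       = refl
map-lookup-allFinL (x ∷ xs) =
  cong (x ∷_) (trans (sym (ListP.map-∘ (allFinL (length xs)))) (map-lookup-allFinL xs))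

foldr-∧-true⁺ : (p : A → Bool) (xs : List A) → (∀ a → p a ≡ true) →
                foldr (λ a acc → p a ∧ acc) true xs ≡ true
foldr-∧-true⁺ p []       _      = refl
foldr-∧-true⁺ p (x ∷ xs) p≡true = cong₂ _∧_ (p≡true x) (foldr-∧-true⁺ p xs p≡true)

foldr-∧-true⁻ : (p : A → Bool) {xs : List A} → foldr (λ a acc → p a ∧ acc) true xs ≡ true →
                ∀ {a} → a ∈ xs → p a ≡ true
foldr-∧-true⁻ p {x ∷ _}  all≡true (here refl) = BoolP.∧-conicalˡ (p x) _ all≡true
foldr-∧-true⁻ p {x ∷ xs} all≡true (there a∈) =
  foldr-∧-true⁻ p (BoolP.∧-conicalʳ (p x) _ all≡true) a∈

∈-allVecs : (x : Vec Bool n) → x ∈ allVecs n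
∈-allVecs []          = here refl
∈-allVecs (false ∷ x) = ∈-++⁺ˡ (∈-map⁺ (false ∷_) (∈-allVecs x))
∈-allVecs (true ∷ x)  = ∈-++⁺ʳ _ (∈-map⁺ (true ∷_) (∈-allVecs x))

allVecs-unique : ∀ n → Unique (allVecs n)
allVecs-unique zero    = All.[] ∷ []
allVecs-unique (suc n) = UniqueP.++⁺ (UniqueP.map⁺ VecP.∷-injectiveʳ (allVecs-unique n))
                                     (UniqueP.map⁺ VecP.∷-injectiveʳ (allVecs-unique n)) disjoint
  where
  disjoint : Disjoint (map (false ∷_) (allVecs n)) (map (true ∷_) (allVecs n))
  disjoint (x∈₀ , x∈₁)
    with _ , _ , refl ← ∈-map⁻ (false ∷_) x∈₀ | _ , _ , () ← ∈-map⁻ (true ∷_) x∈₁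

map-bijection-↭ : {xs : List A} → Unique xs → (∀ x → x ∈ xs) →
                  (σ τ : A → A) → (∀ x → σ (τ x) ≡ x) → (∀ x → τ (σ x) ≡ x) →
                  map σ xs ↭ xs
map-bijection-↭ {xs = xs} unique complete σ τ στ τσ =
  ∼bag⇒↭ (unique∧set⇒bag (UniqueP.map⁺ σ-injective unique) unique
    (λ {x} → mk⇔ (λ _ → complete x) (λ _ → subst (_∈ map σ xs) (στ x) (∈-map⁺ σ (complete (τ x))))))
  where
  σ-injective : ∀ {x y} → σ x ≡ σ y → x ≡ y
  σ-injective {x} {y} eq = trans (sym (τσ x)) (trans (cong τ eq) (τσ y))


-- Counting the solutions of a decidable predicate

count : {P : Pred (Vec Bool m) 0ℓ} → Decidable P → ℕ
count {m} P? = length (filter P? (allVecs m))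

module _ {P : Pred (Vec Bool (suc m)) 0ℓ} (P? : Decidable P) where

  count-split : count P? ≡ count (P? ∘ (false ∷_)) + count (P? ∘ (true ∷_))
  count-split = begin
    length (filter P? (map (false ∷_) (allVecs m) ++ map (true ∷_) (allVecs m)))
      ≡⟨ cong length (ListP.filter-++ P? (map (false ∷_) (allVecs m)) _) ⟩
    length (filter P? (map (false ∷_) (allVecs m)) ++ filter P? (map (true ∷_) (allVecs m)))
      ≡⟨ ListP.length-++ (filter P? (map (false ∷_) (allVecs m))) ⟩
    length (filter P? (map (false ∷_) (allVecs m))) + length (filter P? (map (true ∷_) (allVecs m)))
      ≡⟨ cong₂ _+_ (length-filter-map (false ∷_)) (length-filter-map (true ∷_)) ⟩
    count (P? ∘ (false ∷_)) + count (P? ∘ (true ∷_))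
      ∎
    where
    open ≡-Reasoning
    length-filter-map : ∀ f → length (filter P? (map f (allVecs m))) ≡ length (filter (P? ∘ f) (allVecs m))
    length-filter-map f =
      trans (cong length (filter-map P? f (allVecs m))) (ListP.length-map f (filter (P? ∘ f) (allVecs m)))

count-∘tail : {Q : Pred (Vec Bool m) 0ℓ} (Q? : Decidable Q) → count {suc m} (Q? ∘ tail) ≡ 2 * count Q?
count-∘tail Q? = trans (count-split (Q? ∘ tail)) (cong (_+_ (count Q?)) (sym (ℕP.+-identityʳ (count Q?))))

Satisfying : {P : Pred (Vec Bool m) 0ℓ} → Decidable P → Set
Satisfying {m} P? = Σ (Vec Bool m) (True ∘ P?)

Satisfying-≡ : {P : Pred (Vec Bool m) 0ℓ} {P? : Decidable P} {x y : Vec Bool m} {p : True (P? x)} {q : True (P? y)} →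
               x ≡ y → _≡_ {A = Satisfying P?} (x , p) (y , q)
Satisfying-≡ refl = cong (_ ,_) (BoolP.T-irrelevant _ _)

enumerate : {P : Pred (Vec Bool m) 0ℓ} (P? : Decidable P) → Satisfying P? ↔ Fin (count P?)
enumerate {zero} P? with P? []
... | yes p = mk↔ₛ′ (λ _ → zero) (λ _ → [] , fromWitness p) (λ { zero → refl })
                    (λ { ([] , _) → Satisfying-≡ refl })
... | no ¬p = mk↔ₛ′ (λ { ([] , t) → contradiction (toWitness t) ¬p }) (λ ()) (λ ())
                    (λ { ([] , t) → contradiction (toWitness t) ¬p })
enumerate {suc m} P? =
  ↔-trans split-head (↔-trans (enumerate (P? ∘ (false ∷_)) ⊎-↔ enumerate (P? ∘ (true ∷_)))
                              (↔-trans (↔-sym FinP.+↔⊎) (Fin-cong (sym (count-split P?)))))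
  where
  split-head : Satisfying P? ↔ (Satisfying (P? ∘ (false ∷_)) ⊎ Satisfying (P? ∘ (true ∷_)))
  split-head = mk↔ₛ′ to from (λ { (inj₁ _) → refl ; (inj₂ _) → refl })
                             (λ { (false ∷ _ , _) → refl ; (true ∷ _ , _) → refl })
    where
    to : Satisfying P? → Satisfying (P? ∘ (false ∷_)) ⊎ Satisfying (P? ∘ (true ∷_))
    to (false ∷ x , p) = inj₁ (x , p)
    to (true ∷ x , p)  = inj₂ (x , p)
    from : Satisfying (P? ∘ (false ∷_)) ⊎ Satisfying (P? ∘ (true ∷_)) → Satisfying P?
    from (inj₁ (x , p)) = false ∷ x , p
    from (inj₂ (x , p)) = true ∷ x , p
  Fin-cong : ∀ {a b} → a ≡ b → Fin a ↔ Fin b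
  Fin-cong refl = ↔-refl

record SubsetBijection (P : Pred (Vec Bool m) 0ℓ) (Q : Pred (Vec Bool k) 0ℓ) : Set where
  field
    to       : Vec Bool m → Vec Bool k
    from     : Vec Bool k → Vec Bool m
    to-∈     : ∀ {x} → P x → Q (to x)
    from-∈   : ∀ {y} → Q y → P (from y)
    from∘to  : ∀ {x} → P x → from (to x) ≡ x
    to∘from  : ∀ {y} → Q y → to (from y) ≡ y

count-cong : {P : Pred (Vec Bool m) 0ℓ} {Q : Pred (Vec Bool k) 0ℓ} (P? : Decidable P) (Q? : Decidable Q) →
             SubsetBijection P Q → count P? ≡ count Q?
count-cong P? Q? β = ↔⇒≡ (↔-trans (↔-sym (enumerate P?)) (↔-trans restricted (enumerate Q?)))
  where
  open SubsetBijection β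
  restricted : Satisfying P? ↔ Satisfying Q?
  restricted = mk↔ₛ′ (λ (x , p) → to x , fromWitness (to-∈ (toWitness p)))
                     (λ (y , q) → from y , fromWitness (from-∈ (toWitness q)))
                     (λ (y , q) → Satisfying-≡ (to∘from (toWitness q)))
                     (λ (x , p) → Satisfying-≡ (from∘to (toWitness p)))


mulRow-addAt : (M : Matrix n) (x : Vec Bool n) (v : Fin n) (b : Bool) (i : Fin n) →
               mulRow M (addAt x v b) i ≡ mulRow M x i xor (M i v ∧ b)
mulRow-addAt {n} M x v b i = begin
  xorSum (allFinL n) (λ j → M i j ∧ lookupV (addAt x v b) j)
    ≡⟨ xorSum-cong (allFinL n) entry ⟩
  xorSum (allFinL n) (λ j → (M i j ∧ lookupV x j) xor (δ v j ∧ (M i v ∧ b)))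
    ≡⟨ xorSum-xor (allFinL n) (λ j → M i j ∧ lookupV x j) (λ j → δ v j ∧ (M i v ∧ b)) ⟩
  mulRow M x i xor xorSum (allFinL n) (λ j → δ v j ∧ (M i v ∧ b))
    ≡⟨ cong (mulRow M x i xor_) (xorSum-δ′ v (M i v ∧ b)) ⟩
  mulRow M x i xor (M i v ∧ b)
    ∎
  where
  open ≡-Reasoning
  entry : ∀ j → M i j ∧ lookupV (addAt x v b) j ≡ (M i j ∧ lookupV x j) xor (δ v j ∧ (M i v ∧ b))
  entry j with v FinP.≟ j
  ... | yes refl =
    trans (cong (M i v ∧_) (lookupV-addAt-≡ x v b)) (BoolP.∧-distribˡ-xor (M i v) (lookupV x v) b)
  ... | no v≢j   = trans (cong (M i j ∧_) (lookupV-addAt-≢ x b v≢j)) (sym (BoolP.xor-identityʳ _))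

mulRow-addAt₂ : (M : Matrix n) (x : Vec Bool n) (i : Fin n) (a : Bool) (j : Fin n) (b : Bool) (l : Fin n) →
                mulRow M (addAt₂ x i a j b) l ≡ (mulRow M x l xor (M l i ∧ a)) xor (M l j ∧ b)
mulRow-addAt₂ M x i a j b l =
  trans (mulRow-addAt M (addAt x i a) j b l) (cong (_xor (M l j ∧ b)) (mulRow-addAt M x i a l))

mulRow-cong : (M M′ : Matrix n) (x : Vec Bool n) (i k : Fin n) → (∀ j → x ∋ j → M i j ≡ M′ k j) →
              mulRow M x i ≡ mulRow M′ x k
mulRow-cong {n} M M′ x i k rows≡ = xorSum-cong (allFinL n) entry
  where
  entry : ∀ j → M i j ∧ lookupV x j ≡ M′ k j ∧ lookupV x j
  entry j with lookupV x j in xj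
  ... | true  = trans (BoolP.∧-identityʳ _) (trans (rows≡ j xj) (sym (BoolP.∧-identityʳ _)))
  ... | false = trans (BoolP.∧-zeroʳ _) (sym (BoolP.∧-zeroʳ _))

mulRow-zero : (M : Matrix n) (x : Vec Bool n) (i : Fin n) → (∀ j → x ∋ j → M i j ≡ false) →
              mulRow M x i ≡ false
mulRow-zero {n} M x i row≡0 =
  trans (mulRow-cong M (λ _ _ → false) x i i row≡0) (xorSum-zero (allFinL n) (λ _ → refl))


-- Kernels of principal submatrices

record IsKernelOn (M : Matrix n) (W x : Vec Bool n) : Set where
  field
    support     : ∀ i → x ∋ i → W ∋ i
    annihilated : ∀ i → W ∋ i → mulRow M x i ≡ false

  outside : ∀ i → W ∌ i → x ∌ i
  outside i i∉W with lookupV x i in xi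
  ... | false = refl
  ... | true  with () ← trans (sym (support i xi)) i∉W

isKernelOn? : (M : Matrix n) (W : Vec Bool n) → Decidable (IsKernelOn M W)
isKernelOn? M W x = map′ fromPointwise toPointwise
  (FinP.all? λ i → (x ∋? i →-dec W ∋? i) ×-dec (W ∋? i →-dec (mulRow M x i Bool.≟ false)))
  where
  fromPointwise : _ → IsKernelOn M W x
  fromPointwise k = record { support = proj₁ ∘ k ; annihilated = proj₂ ∘ k }
  toPointwise : IsKernelOn M W x → _
  toPointwise k i = IsKernelOn.support k i , IsKernelOn.annihilated k i

kernelSizeOn : Matrix n → Vec Bool n → ℕ
kernelSizeOn M W = count (isKernelOn? M W)

kernelSizeOn-cong : (M M′ : Matrix n) (W : Vec Bool n) → (∀ k l → W ∋ k → W ∋ l → M k l ≡ M′ k l) →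
                    kernelSizeOn M W ≡ kernelSizeOn M′ W
kernelSizeOn-cong M M′ W agree = count-cong (isKernelOn? M W) (isKernelOn? M′ W) (record
  { to = λ x → x ; from = λ x → x
  ; to-∈ = transfer agree ; from-∈ = transfer (λ k l k∈W l∈W → sym (agree k l k∈W l∈W))
  ; from∘to = λ _ → refl ; to∘from = λ _ → refl })
  where
  transfer : ∀ {A B : Matrix _} → (∀ k l → W ∋ k → W ∋ l → A k l ≡ B k l) →
             ∀ {x} → IsKernelOn A W x → IsKernelOn B W x
  transfer {A} {B} A≡B {x} k = record
    { support     = support
    ; annihilated = λ l l∈W →
        trans (sym (mulRow-cong A B x l l (λ j xj → A≡B l j l∈W (support j xj)))) (annihilated l l∈W) }
    where open IsKernelOn k


-- Reductions of kernel sizes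

module IsolatedVertex {n} (G : Graph n) (W : Vec Bool n) (i : Fin n) (i∈W : W ∋ i)
                      (isolated : ∀ l → W ∋ l → adj G i l ≡ false) where

  M = adj G
  W′ = toggle W i

  column-zero : ∀ l → W ∋ l → M l i ≡ false
  column-zero l l∈W = trans (Graph.sym G l i) (isolated l l∈W)

  clear : Vec Bool n → Vec Bool n
  clear x = addAt x i (lookupV x i)

  clear-∈ : ∀ {x} → IsKernelOn M W x → IsKernelOn M W′ (clear x)
  clear-∈ {x} k = record { support = supp ; annihilated = ann }
    where
    open IsKernelOn k
    supp : ∀ l → clear x ∋ l → W′ ∋ l
    supp l xl with i FinP.≟ l
    ... | yes refl with () ← trans (sym xl) (trans (lookupV-addAt-≡ x i _) (BoolP.xor-same (lookupV x i)))
    ... | no i≢l = trans (lookupV-toggle-≢ W i≢l) (support l (trans (sym (lookupV-addAt-≢ x _ i≢l)) xl))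
    ann : ∀ l → W′ ∋ l → mulRow M (clear x) l ≡ false
    ann l l∈W′ = trans (mulRow-addAt M x i (lookupV x i) l)
                       (cong₂ (λ u c → u xor (c ∧ lookupV x i)) (annihilated l l∈W) (column-zero l l∈W))
      where l∈W = toggle-∋⇒∋ W i∈W l∈W′

  restore-∈ : ∀ {b y} → IsKernelOn M W′ y → IsKernelOn M W (addAt y i b)
  restore-∈ {b} {y} k = record { support = supp ; annihilated = ann }
    where
    open IsKernelOn k
    supp : ∀ l → addAt y i b ∋ l → W ∋ l
    supp l yl with i FinP.≟ l
    ... | yes refl = i∈W
    ... | no i≢l = toggle-∋⇒∋ W i∈W (support l (trans (sym (lookupV-addAt-≢ y b i≢l)) yl))
    row-zero : ∀ l → W ∋ l → mulRow M y l ≡ false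
    row-zero l l∈W with i FinP.≟ l
    ... | yes refl = mulRow-zero M y i (λ j yj → isolated j (toggle-∋⇒∋ W i∈W (support j yj)))
    ... | no i≢l = annihilated l (trans (lookupV-toggle-≢ W i≢l) l∈W)
    ann : ∀ l → W ∋ l → mulRow M (addAt y i b) l ≡ false
    ann l l∈W = trans (mulRow-addAt M y i b l)
                      (cong₂ (λ u c → u xor (c ∧ b)) (row-zero l l∈W) (column-zero l l∈W))

  restore-clear : ∀ {b y} → y ∌ i → lookupV (addAt y i b) i ∷ clear (addAt y i b) ≡ b ∷ y
  restore-clear {b} {y} y∌i =
    cong₂ _∷_ b-at-i (trans (cong (addAt (addAt y i b) i) b-at-i) (addAt-involutive y i b))
    where b-at-i = lookupV-addAt-∌ y b y∌i

  bijection : SubsetBijection (IsKernelOn M W) (IsKernelOn M W′ ∘ tail)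
  bijection = record
    { to      = λ x → lookupV x i ∷ clear x
    ; from    = λ y → addAt (tail y) i (head y)
    ; to-∈    = clear-∈
    ; from-∈  = restore-∈
    ; from∘to = λ {x} _ → addAt-involutive x i (lookupV x i)
    ; to∘from = λ { {b ∷ y} k → restore-clear (IsKernelOn.outside k i (toggle-∌ W i∈W)) }
    }

kernelSizeOn-isolated : (G : Graph n) (W : Vec Bool n) (i : Fin n) → W ∋ i →
                        (∀ l → W ∋ l → adj G i l ≡ false) →
                        kernelSizeOn (adj G) W ≡ 2 * kernelSizeOn (adj G) (toggle W i)
kernelSizeOn-isolated G W i i∈W isolated =
  trans (count-cong (isKernelOn? (adj G) W) (isKernelOn? (adj G) (toggle W i) ∘ tail)
                    (IsolatedVertex.bijection G W i i∈W isolated))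
        (count-∘tail (isKernelOn? (adj G) (toggle W i)))

module EqualRows {n} (G : Graph n) (W : Vec Bool n) {i j : Fin n} (i≢j : i ≢ j) (i∈W : W ∋ i) (j∈W : W ∋ j)
                 (same : ∀ l → W ∋ l → adj G i l ≡ adj G j l) where

  M = adj G
  W′ = toggle W i

  cancel : ∀ l a → W ∋ l → (M l i ∧ a) xor (M l j ∧ a) ≡ false
  cancel l a l∈W = begin
    (M l i ∧ a) xor (M l j ∧ a)  ≡⟨ cong (λ c → (c ∧ a) xor (M l j ∧ a)) columns ⟩
    (M l j ∧ a) xor (M l j ∧ a)  ≡⟨ BoolP.xor-same (M l j ∧ a) ⟩
    false                        ∎
    where
    open ≡-Reasoning
    columns : M l i ≡ M l j
    columns = trans (Graph.sym G l i) (trans (same l l∈W) (Graph.sym G j l))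

  mulRow-shift : ∀ x a l → W ∋ l → mulRow M (addAt₂ x i a j a) l ≡ mulRow M x l
  mulRow-shift x a l l∈W = begin
    mulRow M (addAt₂ x i a j a) l                           ≡⟨ mulRow-addAt₂ M x i a j a l ⟩
    (mulRow M x l xor (M l i ∧ a)) xor (M l j ∧ a)         ≡⟨ BoolP.xor-assoc (mulRow M x l) _ _ ⟩
    mulRow M x l xor ((M l i ∧ a) xor (M l j ∧ a))         ≡⟨ cong (mulRow M x l xor_) (cancel l a l∈W) ⟩
    mulRow M x l xor false                                  ≡⟨ BoolP.xor-identityʳ (mulRow M x l) ⟩
    mulRow M x l                                            ∎
    where open ≡-Reasoning

  shift : Vec Bool n → Vec Bool n
  shift x = addAt₂ x i (lookupV x i) j (lookupV x i)

  shift-∈ : ∀ {x} → IsKernelOn M W x → IsKernelOn M W′ (shift x)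
  shift-∈ {x} k = record { support = supp ; annihilated = ann }
    where
    open IsKernelOn k
    a = lookupV x i
    supp : ∀ l → shift x ∋ l → W′ ∋ l
    supp l xl with i FinP.≟ l | j FinP.≟ l
    ... | yes refl | _ with () ← trans (sym xl) (trans (lookupV-addAt₂-₁ x a a i≢j) (BoolP.xor-same a))
    ... | no i≢l | yes refl = trans (lookupV-toggle-≢ W i≢l) j∈W
    ... | no i≢l | no j≢l = trans (lookupV-toggle-≢ W i≢l)
                                  (support l (trans (sym (lookupV-addAt₂-≢ x a a i≢l j≢l)) xl))
    ann : ∀ l → W′ ∋ l → mulRow M (shift x) l ≡ false
    ann l l∈W′ = trans (mulRow-shift x a l l∈W) (annihilated l l∈W)
      where l∈W = toggle-∋⇒∋ W i∈W l∈W′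

  unshift-∈ : ∀ {b y} → IsKernelOn M W′ y → IsKernelOn M W (addAt₂ y i b j b)
  unshift-∈ {b} {y} k = record { support = supp ; annihilated = ann }
    where
    open IsKernelOn k
    supp : ∀ l → addAt₂ y i b j b ∋ l → W ∋ l
    supp l yl with i FinP.≟ l | j FinP.≟ l
    ... | yes refl | _ = i∈W
    ... | no _ | yes refl = j∈W
    ... | no i≢l | no j≢l =
      toggle-∋⇒∋ W i∈W (support l (trans (sym (lookupV-addAt₂-≢ y b b i≢l j≢l)) yl))
    row-zero : ∀ l → W ∋ l → mulRow M y l ≡ false
    row-zero l l∈W with i FinP.≟ l
    ... | yes refl = trans (mulRow-cong M M y i j (λ l yl → same l (toggle-∋⇒∋ W i∈W (support l yl))))
                           (annihilated j (trans (lookupV-toggle-≢ W i≢j) j∈W))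
    ... | no i≢l = annihilated l (trans (lookupV-toggle-≢ W i≢l) l∈W)
    ann : ∀ l → W ∋ l → mulRow M (addAt₂ y i b j b) l ≡ false
    ann l l∈W = trans (mulRow-shift y b l l∈W) (row-zero l l∈W)

  shift-unshift : ∀ {b y} → y ∌ i → lookupV (addAt₂ y i b j b) i ∷ shift (addAt₂ y i b j b) ≡ b ∷ y
  shift-unshift {b} {y} y∌i = cong₂ _∷_ b-at-i
    (trans (cong (λ c → addAt₂ (addAt₂ y i b j b) i c j c) b-at-i) (addAt₂-involutive y i b j b))
    where b-at-i = trans (lookupV-addAt₂-₁ y b b i≢j) (cong (_xor b) y∌i)

  bijection : SubsetBijection (IsKernelOn M W) (IsKernelOn M W′ ∘ tail)
  bijection = record
    { to      = λ x → lookupV x i ∷ shift x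
    ; from    = λ y → addAt₂ (tail y) i (head y) j (head y)
    ; to-∈    = shift-∈
    ; from-∈  = unshift-∈
    ; from∘to = λ {x} _ → addAt₂-involutive x i (lookupV x i) j (lookupV x i)
    ; to∘from = λ { {b ∷ y} k → shift-unshift (IsKernelOn.outside k i (toggle-∌ W i∈W)) }
    }

kernelSizeOn-equalRows : (G : Graph n) (W : Vec Bool n) {i j : Fin n} → i ≢ j → W ∋ i → W ∋ j →
                         (∀ l → W ∋ l → adj G i l ≡ adj G j l) →
                         kernelSizeOn (adj G) W ≡ 2 * kernelSizeOn (adj G) (toggle W i)
kernelSizeOn-equalRows G W {i} i≢j i∈W j∈W same =
  trans (count-cong (isKernelOn? (adj G) W) (isKernelOn? (adj G) (toggle W i) ∘ tail)
                    (EqualRows.bijection G W i≢j i∈W j∈W same))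
        (count-∘tail (isKernelOn? (adj G) (toggle W i)))

-- Away from i and j, this is the Schur complement over F₂ of the block [[0,1],[1,0]] of the
-- adjacency matrix A at {i, j}, namely A + aᵢ aⱼᵀ + aⱼ aᵢᵀ where aᵢ is the i-th column of A.
pivot : Graph n → Fin n → Fin n → Graph n
pivot G i j = record { adj = P ; sym = P-sym ; irrefl = P-irrefl }
  where
  a = adj G
  P : Matrix _
  P k l = a k l xor ((a k i ∧ a j l) xor (a k j ∧ a i l))
  P-sym : ∀ k l → P k l ≡ P l k
  P-sym k l = cong₂ _xor_ (Graph.sym G k l) (begin
    (a k i ∧ a j l) xor (a k j ∧ a i l)  ≡⟨ BoolP.xor-comm (a k i ∧ a j l) _ ⟩
    (a k j ∧ a i l) xor (a k i ∧ a j l)  ≡⟨ cong₂ _xor_ (BoolP.∧-comm (a k j) _) (BoolP.∧-comm (a k i) _) ⟩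
    (a i l ∧ a k j) xor (a j l ∧ a k i)  ≡⟨ cong₂ _xor_ (cong₂ _∧_ (Graph.sym G i l) (Graph.sym G k j))
                                                        (cong₂ _∧_ (Graph.sym G j l) (Graph.sym G k i)) ⟩
    (a l i ∧ a j k) xor (a l j ∧ a i k)  ∎)
    where open ≡-Reasoning
  P-irrefl : ∀ k → P k k ≡ false
  P-irrefl k = begin
    a k k xor ((a k i ∧ a j k) xor (a k j ∧ a i k))
      ≡⟨ cong₂ (λ u v → u xor ((a k i ∧ v) xor (a k j ∧ a i k))) (Graph.irrefl G k) (Graph.sym G j k) ⟩
    (a k i ∧ a k j) xor (a k j ∧ a i k)
      ≡⟨ cong ((a k i ∧ a k j) xor_) (trans (cong (a k j ∧_) (Graph.sym G i k)) (BoolP.∧-comm (a k j) (a k i))) ⟩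
    (a k i ∧ a k j) xor (a k i ∧ a k j)
      ≡⟨ BoolP.xor-same (a k i ∧ a k j) ⟩
    false
      ∎
    where open ≡-Reasoning

mulRow-pivot : (G : Graph n) (i j : Fin n) (y : Vec Bool n) (k : Fin n) →
               mulRow (adj (pivot G i j)) y k ≡
               mulRow (adj G) y k xor ((adj G k i ∧ mulRow (adj G) y j) xor (adj G k j ∧ mulRow (adj G) y i))
mulRow-pivot {n} G i j y k = begin
  xorSum js (λ l → adj (pivot G i j) k l ∧ ŷ l)
    ≡⟨ xorSum-cong js entry ⟩
  xorSum js (λ l → (a k l ∧ ŷ l) xor ((a k i ∧ (a j l ∧ ŷ l)) xor (a k j ∧ (a i l ∧ ŷ l))))
    ≡⟨ xorSum-xor js (λ l → a k l ∧ ŷ l) _ ⟩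
  mulRow a y k xor xorSum js (λ l → (a k i ∧ (a j l ∧ ŷ l)) xor (a k j ∧ (a i l ∧ ŷ l)))
    ≡⟨ cong (mulRow a y k xor_) (xorSum-xor js (λ l → a k i ∧ (a j l ∧ ŷ l)) _) ⟩
  mulRow a y k xor (xorSum js (λ l → a k i ∧ (a j l ∧ ŷ l)) xor xorSum js (λ l → a k j ∧ (a i l ∧ ŷ l)))
    ≡⟨ cong (mulRow a y k xor_) (cong₂ _xor_ (xorSum-∧ˡ js (a k i) _) (xorSum-∧ˡ js (a k j) _)) ⟩
  mulRow a y k xor ((a k i ∧ mulRow a y j) xor (a k j ∧ mulRow a y i))
    ∎
  where
  open ≡-Reasoning
  a = adj G
  js = allFinL n
  ŷ = lookupV y
  entry : ∀ l → adj (pivot G i j) k l ∧ ŷ l ≡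
                (a k l ∧ ŷ l) xor ((a k i ∧ (a j l ∧ ŷ l)) xor (a k j ∧ (a i l ∧ ŷ l)))
  entry l = begin
    (a k l xor ((a k i ∧ a j l) xor (a k j ∧ a i l))) ∧ ŷ l
      ≡⟨ BoolP.∧-distribʳ-xor (ŷ l) (a k l) _ ⟩
    (a k l ∧ ŷ l) xor (((a k i ∧ a j l) xor (a k j ∧ a i l)) ∧ ŷ l)
      ≡⟨ cong ((a k l ∧ ŷ l) xor_) (BoolP.∧-distribʳ-xor (ŷ l) (a k i ∧ a j l) _) ⟩
    (a k l ∧ ŷ l) xor (((a k i ∧ a j l) ∧ ŷ l) xor ((a k j ∧ a i l) ∧ ŷ l))
      ≡⟨ cong ((a k l ∧ ŷ l) xor_) (cong₂ _xor_ (BoolP.∧-assoc (a k i) _ _) (BoolP.∧-assoc (a k j) _ _)) ⟩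
    (a k l ∧ ŷ l) xor ((a k i ∧ (a j l ∧ ŷ l)) xor (a k j ∧ (a i l ∧ ŷ l)))
      ∎

module Pivot {n} (G : Graph n) (W : Vec Bool n) {i j : Fin n} (i≢j : i ≢ j) (i∈W : W ∋ i) (j∈W : W ∋ j)
             (i~j : adj G i j ≡ true) where

  M = adj G
  P = adj (pivot G i j)
  W″ = toggle (toggle W i) j

  W″∌i : W″ ∌ i
  W″∌i = trans (lookupV-toggle-≢ (toggle W i) (i≢j ∘ sym)) (toggle-∌ W i∈W)

  W″∌j : W″ ∌ j
  W″∌j = toggle-∌ (toggle W i) (trans (lookupV-toggle-≢ W i≢j) j∈W)

  W″-≢ : ∀ {l} → i ≢ l → j ≢ l → lookupV W″ l ≡ lookupV W l
  W″-≢ i≢l j≢l = trans (lookupV-toggle-≢ (toggle W i) j≢l) (lookupV-toggle-≢ W i≢l)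

  j~i : M j i ≡ true
  j~i = trans (Graph.sym G j i) i~j

  strip : Vec Bool n → Vec Bool n
  strip x = addAt₂ x i (lookupV x i) j (lookupV x j)

  restore-strip : ∀ x → addAt₂ (strip x) i (lookupV x i) j (lookupV x j) ≡ x
  restore-strip x = addAt₂-involutive x i (lookupV x i) j (lookupV x j)

  -- Since Mᵢᵢ = 0 and Mᵢⱼ = 1, (M x)ᵢ = (M (strip x))ᵢ + xⱼ, and symmetrically for j.
  pivot-rows : ∀ {x} → IsKernelOn M W x →
               mulRow M (strip x) i ≡ lookupV x j × mulRow M (strip x) j ≡ lookupV x i
  pivot-rows {x} k = xor≡false⇒≡ row-i , xor≡false⇒≡ row-j
    where
    open IsKernelOn k
    open ≡-Reasoning
    s = mulRow M (strip x)
    xᵢ = lookupV x i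
    xⱼ = lookupV x j
    row : ∀ l → mulRow M x l ≡ (s l xor (M l i ∧ xᵢ)) xor (M l j ∧ xⱼ)
    row l = trans (cong (λ z → mulRow M z l) (sym (restore-strip x))) (mulRow-addAt₂ M (strip x) i _ j _ l)
    row-i : s i xor xⱼ ≡ false
    row-i = begin
      s i xor xⱼ
        ≡⟨ cong (_xor xⱼ) (BoolP.xor-identityʳ (s i)) ⟨
      (s i xor false) xor xⱼ
        ≡⟨ cong₂ (λ u v → (s i xor (u ∧ xᵢ)) xor (v ∧ xⱼ)) (Graph.irrefl G i) i~j ⟨
      (s i xor (M i i ∧ xᵢ)) xor (M i j ∧ xⱼ)
        ≡⟨ row i ⟨
      mulRow M x i
        ≡⟨ annihilated i i∈W ⟩
      false
        ∎
    row-j : s j xor xᵢ ≡ false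
    row-j = begin
      s j xor xᵢ
        ≡⟨ BoolP.xor-identityʳ _ ⟨
      (s j xor xᵢ) xor false
        ≡⟨ cong₂ (λ u v → (s j xor (u ∧ xᵢ)) xor (v ∧ xⱼ)) j~i (Graph.irrefl G j) ⟨
      (s j xor (M j i ∧ xᵢ)) xor (M j j ∧ xⱼ)
        ≡⟨ row j ⟨
      mulRow M x j
        ≡⟨ annihilated j j∈W ⟩
      false
        ∎

  strip-∈ : ∀ {x} → IsKernelOn M W x → IsKernelOn P W″ (strip x)
  strip-∈ {x} k = record { support = supp ; annihilated = ann }
    where
    open IsKernelOn k
    supp : ∀ l → strip x ∋ l → W″ ∋ l
    supp l xl with i FinP.≟ l | j FinP.≟ l
    ... | yes refl | _
      with () ← trans (sym xl) (trans (lookupV-addAt₂-₁ x _ _ i≢j) (BoolP.xor-same (lookupV x i)))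
    ... | no _ | yes refl
      with () ← trans (sym xl) (trans (lookupV-addAt₂-₂ x _ _ i≢j) (BoolP.xor-same (lookupV x j)))
    ... | no i≢l | no j≢l =
      trans (W″-≢ i≢l j≢l) (support l (trans (sym (lookupV-addAt₂-≢ x _ _ i≢l j≢l)) xl))
    ann : ∀ l → W″ ∋ l → mulRow P (strip x) l ≡ false
    ann l l∈W″ with i FinP.≟ l | j FinP.≟ l
    ... | yes refl | _ with () ← trans (sym l∈W″) W″∌i
    ... | no _ | yes refl with () ← trans (sym l∈W″) W″∌j
    ... | no i≢l | no j≢l = begin
      mulRow P (strip x) l
        ≡⟨ mulRow-pivot G i j (strip x) l ⟩
      mulRow M (strip x) l xor ((M l i ∧ mulRow M (strip x) j) xor (M l j ∧ mulRow M (strip x) i))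
        ≡⟨ cong₂ (λ u v → mulRow M (strip x) l xor ((M l i ∧ u) xor (M l j ∧ v)))
                 (proj₂ (pivot-rows k)) (proj₁ (pivot-rows k)) ⟩
      mulRow M (strip x) l xor ((M l i ∧ lookupV x i) xor (M l j ∧ lookupV x j))
        ≡⟨ BoolP.xor-assoc (mulRow M (strip x) l) _ _ ⟨
      (mulRow M (strip x) l xor (M l i ∧ lookupV x i)) xor (M l j ∧ lookupV x j)
        ≡⟨ mulRow-addAt₂ M (strip x) i _ j _ l ⟨
      mulRow M (addAt₂ (strip x) i (lookupV x i) j (lookupV x j)) l
        ≡⟨ cong (λ z → mulRow M z l) (restore-strip x) ⟩
      mulRow M x l
        ≡⟨ annihilated l (trans (sym (W″-≢ i≢l j≢l)) l∈W″) ⟩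
      false
        ∎
      where open ≡-Reasoning

  lift : Vec Bool n → Vec Bool n
  lift y = addAt₂ y i (mulRow M y j) j (mulRow M y i)

  lift-∈ : ∀ {y} → IsKernelOn P W″ y → IsKernelOn M W (lift y)
  lift-∈ {y} k = record { support = supp ; annihilated = ann }
    where
    open IsKernelOn k
    open ≡-Reasoning
    a = mulRow M y j
    b = mulRow M y i
    supp : ∀ l → lift y ∋ l → W ∋ l
    supp l yl with i FinP.≟ l | j FinP.≟ l
    ... | yes refl | _ = i∈W
    ... | no _ | yes refl = j∈W
    ... | no i≢l | no j≢l =
      trans (sym (W″-≢ i≢l j≢l)) (support l (trans (sym (lookupV-addAt₂-≢ y _ _ i≢l j≢l)) yl))
    ann : ∀ l → W ∋ l → mulRow M (lift y) l ≡ false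
    ann l l∈W with i FinP.≟ l | j FinP.≟ l
    ... | yes refl | _ = begin
      mulRow M (lift y) i
        ≡⟨ mulRow-addAt₂ M y i a j b i ⟩
      (b xor (M i i ∧ a)) xor (M i j ∧ b)
        ≡⟨ cong₂ (λ u v → (b xor (u ∧ a)) xor (v ∧ b)) (Graph.irrefl G i) i~j ⟩
      (b xor false) xor b
        ≡⟨ cong (_xor b) (BoolP.xor-identityʳ b) ⟩
      b xor b
        ≡⟨ BoolP.xor-same b ⟩
      false
        ∎
    ... | no _ | yes refl = begin
      mulRow M (lift y) j
        ≡⟨ mulRow-addAt₂ M y i a j b j ⟩
      (a xor (M j i ∧ a)) xor (M j j ∧ b)
        ≡⟨ cong₂ (λ u v → (a xor (u ∧ a)) xor (v ∧ b)) j~i (Graph.irrefl G j) ⟩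
      (a xor a) xor false
        ≡⟨ BoolP.xor-identityʳ (a xor a) ⟩
      a xor a
        ≡⟨ BoolP.xor-same a ⟩
      false
        ∎
    ... | no i≢l | no j≢l = begin
      mulRow M (lift y) l                                    ≡⟨ mulRow-addAt₂ M y i a j b l ⟩
      (mulRow M y l xor (M l i ∧ a)) xor (M l j ∧ b)        ≡⟨ BoolP.xor-assoc (mulRow M y l) _ _ ⟩
      mulRow M y l xor ((M l i ∧ a) xor (M l j ∧ b))        ≡⟨ mulRow-pivot G i j y l ⟨
      mulRow P y l                                           ≡⟨ annihilated l (trans (W″-≢ i≢l j≢l) l∈W) ⟩
      false                                                  ∎

  strip-lift : ∀ {y} → IsKernelOn P W″ y → strip (lift y) ≡ y
  strip-lift {y} k = trans (cong₂ (λ u v → addAt₂ (lift y) i u j v) at-i at-j) (addAt₂-involutive y i _ j _)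
    where
    open IsKernelOn k
    at-i : lookupV (lift y) i ≡ mulRow M y j
    at-i = trans (lookupV-addAt₂-₁ y _ _ i≢j) (cong (_xor mulRow M y j) (outside i W″∌i))
    at-j : lookupV (lift y) j ≡ mulRow M y i
    at-j = trans (lookupV-addAt₂-₂ y _ _ i≢j) (cong (_xor mulRow M y i) (outside j W″∌j))

  lift-strip : ∀ {x} → IsKernelOn M W x → lift (strip x) ≡ x
  lift-strip {x} k =
    trans (cong₂ (λ u v → addAt₂ (strip x) i u j v) (proj₂ (pivot-rows k)) (proj₁ (pivot-rows k)))
          (restore-strip x)

  bijection : SubsetBijection (IsKernelOn M W) (IsKernelOn P W″)
  bijection = record
    { to = strip ; from = lift ; to-∈ = strip-∈ ; from-∈ = lift-∈ ; from∘to = lift-strip ; to∘from = strip-lift }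

kernelSizeOn-pivot : (G : Graph n) (W : Vec Bool n) {i j : Fin n} → i ≢ j → W ∋ i → W ∋ j →
                     adj G i j ≡ true →
                     kernelSizeOn (adj G) W ≡ kernelSizeOn (adj (pivot G i j)) (toggle (toggle W i) j)
kernelSizeOn-pivot G W {i} {j} i≢j i∈W j∈W i~j =
  count-cong (isKernelOn? (adj G) W) (isKernelOn? (adj (pivot G i j)) (toggle (toggle W i) j))
             (Pivot.bijection G W i≢j i∈W j∈W i~j)

tailMatrix : Matrix (suc n) → Matrix n
tailMatrix M k l = M (suc k) (suc l)

mulRow-∷ : (M : Matrix (suc n)) (b : Bool) (x : Vec Bool n) (l : Fin n) →
           mulRow M (b ∷ x) (suc l) ≡ (M (suc l) zero ∧ b) xor mulRow (tailMatrix M) x l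
mulRow-∷ {n} M b x l = xorSum-allFinL-suc {n} (λ j → M (suc l) j ∧ lookupV (b ∷ x) j)

mulRow-false∷ : (M : Matrix (suc n)) (x : Vec Bool n) (l : Fin n) →
                mulRow M (false ∷ x) (suc l) ≡ mulRow (tailMatrix M) x l
mulRow-false∷ M x l =
  trans (mulRow-∷ M false x l) (cong (_xor mulRow (tailMatrix M) x l) (BoolP.∧-zeroʳ (M (suc l) zero)))

kernelSizeOn-false∷ : (M : Matrix (suc n)) (W : Vec Bool n) →
                      kernelSizeOn M (false ∷ W) ≡ kernelSizeOn (tailMatrix M) W
kernelSizeOn-false∷ M W = count-cong (isKernelOn? M (false ∷ W)) (isKernelOn? (tailMatrix M) W) (record
  { to = tail ; from = false ∷_ ; to-∈ = tail-∈ ; from-∈ = false∷-∈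
  ; from∘to = λ { {b ∷ x} k → cong (_∷ x) (sym (IsKernelOn.outside k zero refl)) }
  ; to∘from = λ _ → refl })
  where
  tail-∈ : ∀ {x} → IsKernelOn M (false ∷ W) x → IsKernelOn (tailMatrix M) W (tail x)
  tail-∈ {b ∷ x} k = record
    { support     = λ l → support (suc l)
    ; annihilated = λ l l∈W → trans (sym (mulRow-false∷ M x l))
        (subst (λ c → mulRow M (c ∷ x) (suc l) ≡ false) (outside zero refl) (annihilated (suc l) l∈W)) }
    where open IsKernelOn k
  false∷-∈ : ∀ {x} → IsKernelOn (tailMatrix M) W x → IsKernelOn M (false ∷ W) (false ∷ x)
  false∷-∈ {x} k = record { support = supp ; annihilated = ann }
    where
    open IsKernelOn k
    supp : ∀ l → (false ∷ x) ∋ l → (false ∷ W) ∋ l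
    supp (suc l) xl = support l xl
    ann : ∀ l → (false ∷ W) ∋ l → mulRow M (false ∷ x) l ≡ false
    ann (suc l) l∈W = trans (mulRow-false∷ M x l) (annihilated l l∈W)

module TwinMove {n} (G : Graph n) {p q : Fin n} (p≢q : p ≢ q)
                (twins : ∀ l → p ≢ l → q ≢ l → adj G p l ≡ adj G q l)
                (W : Vec Bool n) (p∈W : W ∋ p) (q∉W : W ∌ q) where

  M = adj G
  W′ = toggle (toggle W p) q

  move-∈ : ∀ {x} → IsKernelOn M W x → IsKernelOn M W′ (move p q x)
  move-∈ {x} k = record { support = supp ; annihilated = ann }
    where
    open IsKernelOn k
    open ≡-Reasoning
    a = lookupV x p
    x′ = addAt x p a
    supp : ∀ l → move p q x ∋ l → W′ ∋ l
    supp l xl with p FinP.≟ l | q FinP.≟ l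
    ... | yes refl | _ with () ← trans (sym xl) (trans (lookupV-addAt₂-₁ x a a p≢q) (BoolP.xor-same a))
    ... | no p≢l | yes refl = toggle-∋ (toggle W p) (trans (lookupV-toggle-≢ W p≢q) q∉W)
    ... | no p≢l | no q≢l = trans (lookupV-toggle-≢ (toggle W p) q≢l)
      (trans (lookupV-toggle-≢ W p≢l) (support l (trans (sym (lookupV-addAt₂-≢ x a a p≢l q≢l)) xl)))
    rows-agree : ∀ j → x′ ∋ j → M q j ≡ M p j
    rows-agree j x′j with p FinP.≟ j | q FinP.≟ j
    ... | yes refl | _ with () ← trans (sym x′j) (trans (lookupV-addAt-≡ x p a) (BoolP.xor-same a))
    ... | no _ | yes refl with () ← trans (sym x′j) (trans (lookupV-addAt-≢ x a p≢q) (outside q q∉W))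
    ... | no p≢j | no q≢j = sym (twins j p≢j q≢j)
    ann : ∀ l → W′ ∋ l → mulRow M (move p q x) l ≡ false
    ann l l∈W′ with p FinP.≟ l | q FinP.≟ l
    ... | yes refl | _
      with () ← trans (sym l∈W′) (trans (lookupV-toggle-≢ (toggle W p) (p≢q ∘ sym)) (toggle-∌ W p∈W))
    ... | no _ | yes refl = begin
      mulRow M (addAt x′ q a) q       ≡⟨ mulRow-addAt M x′ q a q ⟩
      mulRow M x′ q xor (M q q ∧ a)   ≡⟨ cong (λ c → mulRow M x′ q xor (c ∧ a)) (Graph.irrefl G q) ⟩
      mulRow M x′ q xor false         ≡⟨ BoolP.xor-identityʳ _ ⟩
      mulRow M x′ q                   ≡⟨ mulRow-cong M M x′ q p rows-agree ⟩
      mulRow M x′ p                   ≡⟨ mulRow-addAt M x p a p ⟩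
      mulRow M x p xor (M p p ∧ a)    ≡⟨ cong₂ (λ u c → u xor (c ∧ a)) (annihilated p p∈W) (Graph.irrefl G p) ⟩
      false                           ∎
    ... | no p≢l | no q≢l = begin
      mulRow M (move p q x) l
        ≡⟨ mulRow-addAt₂ M x p a q a l ⟩
      (mulRow M x l xor (M l p ∧ a)) xor (M l q ∧ a)
        ≡⟨ BoolP.xor-assoc (mulRow M x l) _ _ ⟩
      mulRow M x l xor ((M l p ∧ a) xor (M l q ∧ a))
        ≡⟨ cong (λ c → mulRow M x l xor ((c ∧ a) xor (M l q ∧ a))) columns ⟩
      mulRow M x l xor ((M l q ∧ a) xor (M l q ∧ a))
        ≡⟨ cong (mulRow M x l xor_) (BoolP.xor-same (M l q ∧ a)) ⟩
      mulRow M x l xor false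
        ≡⟨ BoolP.xor-identityʳ _ ⟩
      mulRow M x l
        ≡⟨ annihilated l l∈W ⟩
      false
        ∎
      where
      l∈W = trans (sym (trans (lookupV-toggle-≢ (toggle W p) q≢l) (lookupV-toggle-≢ W p≢l))) l∈W′
      columns : M l p ≡ M l q
      columns = trans (Graph.sym G l p) (trans (twins l p≢l q≢l) (Graph.sym G q l))

kernelSizeOn-twins : (G : Graph n) {u v : Fin n} → u ≢ v → (∀ l → u ≢ l → v ≢ l → adj G u l ≡ adj G v l) →
                     (W : Vec Bool n) → W ∋ u → W ∌ v →
                     kernelSizeOn (adj G) W ≡ kernelSizeOn (adj G) (toggle (toggle W u) v)
kernelSizeOn-twins G {u} {v} u≢v twins W u∈W v∉W = count-cong (isKernelOn? M W) (isKernelOn? M W′) (record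
  { to      = move u v
  ; from    = move v u
  ; to-∈    = TwinMove.move-∈ G u≢v twins W u∈W v∉W
  ; from-∈  = subst (λ V → IsKernelOn M V _) (toggle₂-swap-involutive W u v)
              ∘ TwinMove.move-∈ G (u≢v ∘ sym) (λ l v≢l u≢l → sym (twins l u≢l v≢l)) W′ v∈W′ u∉W′
  ; from∘to = λ {x} k → move-move x u≢v (IsKernelOn.outside k v v∉W)
  ; to∘from = λ {y} k → move-move y (u≢v ∘ sym) (IsKernelOn.outside k u u∉W′)
  })
  where
  M = adj G
  W′ = toggle (toggle W u) v
  v∈W′ : W′ ∋ v
  v∈W′ = toggle-∋ (toggle W u) (trans (lookupV-toggle-≢ W u≢v) v∉W)
  u∉W′ : W′ ∌ u
  u∉W′ = trans (lookupV-toggle-≢ (toggle W u) (u≢v ∘ sym)) (toggle-∌ W u∈W)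

kernelSizeOn-extend-pivot : (G : Graph n) (N : Fin n → Bool) (W : Vec Bool n) {v : Fin n} →
                            N v ≡ true → W ∋ v →
                            (∀ k l → k ≢ v → l ≢ v → (N k ∧ adj G v l) ≡ (adj G k v ∧ N l)) →
                            kernelSizeOn (adj (extend G N)) (true ∷ W) ≡ kernelSizeOn (adj G) (toggle W v)
kernelSizeOn-extend-pivot G N W {v} Nv v∈W unchanged = begin
  kernelSizeOn (adj E) (true ∷ W)
    ≡⟨ kernelSizeOn-pivot E (true ∷ W) (λ ()) refl v∈W Nv ⟩
  kernelSizeOn (adj (pivot E zero (suc v))) (false ∷ toggle W v)
    ≡⟨ kernelSizeOn-cong _ (adj E) (false ∷ toggle W v) agree ⟩
  kernelSizeOn (adj E) (false ∷ toggle W v)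
    ≡⟨ kernelSizeOn-false∷ (adj E) (toggle W v) ⟩
  kernelSizeOn (adj G) (toggle W v)
    ∎
  where
  open ≡-Reasoning
  E = extend G N
  agree : ∀ k l → (false ∷ toggle W v) ∋ k → (false ∷ toggle W v) ∋ l →
          adj (pivot E zero (suc v)) k l ≡ adj E k l
  agree (suc k) (suc l) k∈W′ l∈W′ = begin
    adj G k l xor ((N k ∧ adj G v l) xor (adj G k v ∧ N l))
      ≡⟨ cong (λ c → adj G k l xor (c xor (adj G k v ∧ N l))) (unchanged k l (≢v k∈W′) (≢v l∈W′)) ⟩
    adj G k l xor ((adj G k v ∧ N l) xor (adj G k v ∧ N l))
      ≡⟨ cong (adj G k l xor_) (BoolP.xor-same (adj G k v ∧ N l)) ⟩
    adj G k l xor false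
      ≡⟨ BoolP.xor-identityʳ (adj G k l) ⟩
    adj G k l
      ∎
    where
    ≢v : ∀ {j} → toggle W v ∋ j → j ≢ v
    ≢v j∈W′ = ∌⇒≢ {W = toggle W v} (toggle-∌ W v∈W) j∈W′

kernelSizeOn-extend-twin : (G : Graph n) (N : Fin n → Bool) (W : Vec Bool n) {v : Fin n} → W ∌ v →
                           (∀ l → v ≢ l → N l ≡ adj G v l) →
                           kernelSizeOn (adj (extend G N)) (true ∷ W) ≡ kernelSizeOn (adj G) (toggle W v)
kernelSizeOn-extend-twin G N W {v} v∉W N≡row =
  trans (kernelSizeOn-twins (extend G N) (λ ()) twins (true ∷ W) refl v∉W)
        (kernelSizeOn-false∷ (adj (extend G N)) (toggle W v))
  where
  twins : ∀ l → zero ≢ l → suc v ≢ l → adj (extend G N) zero l ≡ adj (extend G N) (suc v) l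
  twins zero    0≢0 _     = contradiction refl 0≢0
  twins (suc l) _   v≢l   = N≡row l (v≢l ∘ cong suc)

module _ (G : Graph n) (v : Fin n) (W : Vec Bool n) where

  kernelSizeOn-pendant-∋ : W ∋ v →
                           kernelSizeOn (adj (extend G (pendantN v))) (true ∷ W) ≡ kernelSizeOn (adj G) (toggle W v)
  kernelSizeOn-pendant-∋ v∈W = kernelSizeOn-extend-pivot G (pendantN v) W (⌊≟⌋-refl v) v∈W unchanged
    where
    unchanged : ∀ k l → k ≢ v → l ≢ v → (pendantN v k ∧ adj G v l) ≡ (adj G k v ∧ pendantN v l)
    unchanged k l k≢v l≢v = trans (cong (_∧ adj G v l) (⌊≟⌋-≢ k≢v))
                                  (sym (trans (cong (adj G k v ∧_) (⌊≟⌋-≢ l≢v)) (BoolP.∧-zeroʳ (adj G k v))))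

  kernelSizeOn-pendant-∌ : W ∌ v →
                           kernelSizeOn (adj (extend G (pendantN v))) (true ∷ W) ≡ 2 * kernelSizeOn (adj G) W
  kernelSizeOn-pendant-∌ v∉W =
    trans (kernelSizeOn-isolated E (true ∷ W) zero refl isolated) (cong (2 *_) (kernelSizeOn-false∷ (adj E) W))
    where
    E = extend G (pendantN v)
    isolated : ∀ l → (true ∷ W) ∋ l → adj E zero l ≡ false
    isolated zero    _   = refl
    isolated (suc l) l∈W = ⌊≟⌋-≢ (∌⇒≢ {W = W} v∉W l∈W)

  kernelSizeOn-trueTwin :
    kernelSizeOn (adj (extend G (trueTwinN G v))) (true ∷ W) ≡ kernelSizeOn (adj G) (toggle W v)
  kernelSizeOn-trueTwin with lookupV W v in Wv
  ... | true  = kernelSizeOn-extend-pivot G (trueTwinN G v) W Nv Wv unchanged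
    where
    Nv : trueTwinN G v v ≡ true
    Nv = cong₂ _∨_ (Graph.irrefl G v) (⌊≟⌋-refl v)
    N≡row : ∀ {l} → l ≢ v → trueTwinN G v l ≡ adj G v l
    N≡row l≢v = trans (cong (adj G v _ ∨_) (⌊≟⌋-≢ l≢v)) (BoolP.∨-identityʳ _)
    unchanged : ∀ k l → k ≢ v → l ≢ v → (trueTwinN G v k ∧ adj G v l) ≡ (adj G k v ∧ trueTwinN G v l)
    unchanged k l k≢v l≢v = cong₂ _∧_ (trans (N≡row k≢v) (Graph.sym G v k)) (sym (N≡row l≢v))
  ... | false = kernelSizeOn-extend-twin G (trueTwinN G v) W Wv
                  (λ l v≢l → trans (cong (adj G v l ∨_) (⌊≟⌋-≢ (v≢l ∘ sym))) (BoolP.∨-identityʳ _))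

  kernelSizeOn-falseTwin-∋ : W ∋ v →
                             kernelSizeOn (adj (extend G (falseTwinN G v))) (true ∷ W) ≡ 2 * kernelSizeOn (adj G) W
  kernelSizeOn-falseTwin-∋ v∈W = trans (kernelSizeOn-equalRows E (true ∷ W) {zero} {suc v} (λ ()) refl v∈W same)
                                       (cong (2 *_) (kernelSizeOn-false∷ (adj E) W))
    where
    E = extend G (falseTwinN G v)
    same : ∀ l → (true ∷ W) ∋ l → adj E zero l ≡ adj E (suc v) l
    same zero    _ = sym (Graph.irrefl G v)
    same (suc l) _ = refl

  kernelSizeOn-falseTwin-∌ :
    W ∌ v → kernelSizeOn (adj (extend G (falseTwinN G v))) (true ∷ W) ≡ kernelSizeOn (adj G) (toggle W v)
  kernelSizeOn-falseTwin-∌ v∉W = kernelSizeOn-extend-twin G (falseTwinN G v) W v∉W (λ _ _ → refl)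


-- Kernel sizes are powers of two

size : Vec Bool n → ℕ
size []          = 0
size (true ∷ W)  = suc (size W)
size (false ∷ W) = size W

parity : Vec Bool n → Bool
parity []      = false
parity (b ∷ W) = b xor parity W

isOdd : ℕ → Bool
isOdd zero    = false
isOdd (suc k) = not (isOdd k)

size-toggle : (W : Vec Bool n) {i : Fin n} → W ∋ i → suc (size (toggle W i)) ≡ size W
size-toggle (true ∷ W)  {zero}  refl = refl
size-toggle (true ∷ W)  {suc i} i∈W  = cong suc (size-toggle W i∈W)
size-toggle (false ∷ W) {suc i} i∈W  = size-toggle W i∈W

parity-toggle : (W : Vec Bool n) (i : Fin n) → parity (toggle W i) ≡ not (parity W)
parity-toggle (true ∷ W)  zero    = sym (BoolP.not-involutive (parity W))
parity-toggle (false ∷ W) zero    = refl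
parity-toggle (b ∷ W)     (suc i) =
  trans (cong (b xor_) (parity-toggle W i)) (sym (BoolP.not-distribʳ-xor b (parity W)))

parity-empty : (W : Vec Bool n) → (∀ l → W ∌ l) → parity W ≡ false
parity-empty []      _     = refl
parity-empty (b ∷ W) empty = cong₂ _xor_ (empty zero) (parity-empty W (empty ∘ suc))

lookupV-replicate : (l : Fin n) → lookupV (replicate n false) l ≡ false
lookupV-replicate zero    = refl
lookupV-replicate (suc l) = lookupV-replicate l

kernelSizeOn-empty : (M : Matrix n) (W : Vec Bool n) → (∀ l → W ∌ l) → kernelSizeOn M W ≡ 1
kernelSizeOn-empty {n} M W empty = count-cong (isKernelOn? M W) (λ (_ : Vec Bool 0) → yes tt) (record
  { to = λ _ → [] ; from = λ _ → replicate n false ; to-∈ = λ _ → tt ; from-∈ = λ _ → zero-∈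
  ; from∘to = λ k → lookupV-injective (λ l → trans (lookupV-replicate l) (sym (IsKernelOn.outside k l (empty l))))
  ; to∘from = λ { {[]} _ → refl } })
  where
  zero-∈ : IsKernelOn M W (replicate n false)
  zero-∈ = record
    { support     = λ l 0∋l → contradiction (trans (sym 0∋l) (lookupV-replicate l)) λ ()
    ; annihilated = λ l l∈W → contradiction (trans (sym l∈W) (empty l)) λ () }

IsPowerOfTwoWithParity : ℕ → Bool → Set
IsPowerOfTwoWithParity K p = Σ ℕ λ k → K ≡ 2 ^ k × isOdd k ≡ p

double-power : ∀ {K p} → IsPowerOfTwoWithParity K p → IsPowerOfTwoWithParity (2 * K) (not p)
double-power (k , K≡2^k , odd) = suc k , cong (2 *_) K≡2^k , cong not odd

kernelSizeOn-powerOfTwo : (G : Graph n) (W : Vec Bool n) →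
                          IsPowerOfTwoWithParity (kernelSizeOn (adj G) W) (parity W)
kernelSizeOn-powerOfTwo G W = bySize (size W) G W ℕP.≤-refl
  where
  bySize : ∀ {n} m (G : Graph n) W → size W ≤ m → IsPowerOfTwoWithParity (kernelSizeOn (adj G) W) (parity W)
  bySize m G W size≤m with FinP.any? (W ∋?_)
  ... | no ∄i = 0 , kernelSizeOn-empty (adj G) W empty , sym (parity-empty W empty)
    where
    empty : ∀ l → W ∌ l
    empty l = BoolP.¬-not (∄i ∘ (l ,_))
  bySize zero G W size≤0 | yes (i , i∈W) =
    contradiction (subst (_≤ 0) (sym (size-toggle W i∈W)) size≤0) λ ()
  bySize (suc m) G W size≤m | yes (i , i∈W) with FinP.any? (λ j → (W ∋? j) ×-dec (adj G i j Bool.≟ true))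
  ... | no ∄j = subst₂ IsPowerOfTwoWithParity
                  (sym (kernelSizeOn-isolated G W i i∈W isolated))
                  (trans (cong not (parity-toggle W i)) (BoolP.not-involutive (parity W)))
                  (double-power (bySize m G (toggle W i) size≤))
    where
    size≤ : size (toggle W i) ≤ m
    size≤ = s≤s⁻¹ (subst (_≤ suc m) (sym (size-toggle W i∈W)) size≤m)
    isolated : ∀ l → W ∋ l → adj G i l ≡ false
    isolated l l∈W = BoolP.¬-not (λ i~l → ∄j (l , l∈W , i~l))
  ... | yes (j , j∈W , i~j) = subst₂ IsPowerOfTwoWithParity
                  (sym (kernelSizeOn-pivot G W i≢j i∈W j∈W i~j))
                  (trans (parity-toggle W′ j)
                         (trans (cong not (parity-toggle W i)) (BoolP.not-involutive (parity W))))
                  (bySize m (pivot G i j) (toggle W′ j) size≤)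
    where
    W′ = toggle W i
    i≢j : i ≢ j
    i≢j refl with () ← trans (sym i~j) (Graph.irrefl G i)
    size≤ : size (toggle W′ j) ≤ m
    size≤ = ℕP.≤-trans (ℕP.n≤1+n _) (s≤s⁻¹ (subst (_≤ suc m) (sym shrink) size≤m))
      where
      shrink : suc (suc (size (toggle W′ j))) ≡ size W
      shrink = trans (cong suc (size-toggle W′ (trans (lookupV-toggle-≢ W i≢j) j∈W))) (size-toggle W i∈W)


-- Induced subgraphs

inKernel⁻ : (N : Matrix m) (y : Vec Bool m) → inKernel N y ≡ true → ∀ a → mulRow N y a ≡ false
inKernel⁻ N y ker a = BoolP.not-injective (foldr-∧-true⁻ (not ∘ mulRow N y) ker (∈-allFinL a))

module InducedSubgraph {n} (M : Matrix n) (W : Vec Bool n) where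

  card = length (members W)
  e : Fin card → Fin n
  e = lookup (members W)
  N : Matrix card
  N a b = M (e a) (e b)

  e-∈ : ∀ a → W ∋ e a
  e-∈ a = proj₂ (∈-filter⁻ (W ∋?_) {xs = allFinL n} (∈-lookup a))

  e-onto : ∀ l → W ∋ l → ∃ λ a → e a ≡ l
  e-onto l l∈W = index l∈ , sym (lookup-index l∈)
    where l∈ = ∈-filter⁺ (W ∋?_) (∈-allFinL l) l∈W

  e-injective : ∀ a b → e a ≡ e b → a ≡ b
  e-injective = lookup-injective (UniqueP.filter⁺ (W ∋?_) (allFinL-unique n))

  xorSum-filter : ∀ js f → xorSum (filter (W ∋?_) js) f ≡ xorSum js (λ l → lookupV W l ∧ f l)
  xorSum-filter []       f = refl
  xorSum-filter (j ∷ js) f with lookupV W j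
  ... | true  = cong (f j xor_) (xorSum-filter js f)
  ... | false = xorSum-filter js f

  xorSum-∘e : ∀ f → xorSum (allFinL card) (f ∘ e) ≡ xorSum (allFinL n) (λ l → lookupV W l ∧ f l)
  xorSum-∘e f = begin
    xorSum (allFinL card) (f ∘ e)                 ≡⟨ xorSum-map e (allFinL card) f ⟨
    xorSum (map e (allFinL card)) f               ≡⟨ cong (λ js → xorSum js f) (map-lookup-allFinL (members W)) ⟩
    xorSum (members W) f                          ≡⟨ xorSum-filter (allFinL n) f ⟩
    xorSum (allFinL n) (λ l → lookupV W l ∧ f l)  ∎
    where open ≡-Reasoning

  gather : Vec Bool n → Vec Bool card
  gather x = tabulate (lookupV x ∘ e)

  scatter : Vec Bool card → Vec Bool n
  scatter y = tabulate (λ l → xorSum (allFinL card) (λ a → δ (e a) l ∧ lookupV y a))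

  within-W : ∀ x → (∀ l → x ∋ l → W ∋ l) →
             ∀ l c → lookupV W l ∧ (c ∧ lookupV x l) ≡ c ∧ lookupV x l
  within-W x support l c with lookupV x l in xl
  ... | true  = cong (_∧ (c ∧ true)) (support l xl)
  ... | false =
    trans (cong (lookupV W l ∧_) (BoolP.∧-zeroʳ c)) (trans (BoolP.∧-zeroʳ _) (sym (BoolP.∧-zeroʳ c)))

  mulRow-gather : ∀ x → (∀ l → x ∋ l → W ∋ l) → ∀ a → mulRow N (gather x) a ≡ mulRow M x (e a)
  mulRow-gather x support a = begin
    xorSum (allFinL card) (λ b → N a b ∧ lookupV (gather x) b)
      ≡⟨ xorSum-cong (allFinL card) (λ b → cong (N a b ∧_) (lookupV-tabulate _ b)) ⟩
    xorSum (allFinL card) (λ b → M (e a) (e b) ∧ lookupV x (e b))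
      ≡⟨ xorSum-∘e (λ l → M (e a) l ∧ lookupV x l) ⟩
    xorSum (allFinL n) (λ l → lookupV W l ∧ (M (e a) l ∧ lookupV x l))
      ≡⟨ xorSum-cong (allFinL n) (λ l → within-W x support l (M (e a) l)) ⟩
    xorSum (allFinL n) (λ l → M (e a) l ∧ lookupV x l)
      ∎
    where open ≡-Reasoning

  lookupV-scatter-e : ∀ y a → lookupV (scatter y) (e a) ≡ lookupV y a
  lookupV-scatter-e y a = begin
    lookupV (scatter y) (e a)                                  ≡⟨ lookupV-tabulate _ (e a) ⟩
    xorSum (allFinL card) (λ b → δ (e b) (e a) ∧ lookupV y b)  ≡⟨ xorSum-cong (allFinL card) entry ⟩
    xorSum (allFinL card) (λ b → δ b a ∧ lookupV y a)          ≡⟨ xorSum-δ a (lookupV y a) ⟩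
    lookupV y a                                                ∎
    where
    open ≡-Reasoning
    entry : ∀ b → δ (e b) (e a) ∧ lookupV y b ≡ δ b a ∧ lookupV y a
    entry b with b FinP.≟ a
    ... | yes refl = cong (_∧ lookupV y b) (δ-refl (e b))
    ... | no b≢a   = cong (_∧ lookupV y b) (δ-≢ (b≢a ∘ e-injective b a))

  lookupV-scatter-∌ : ∀ y {l} → W ∌ l → lookupV (scatter y) l ≡ false
  lookupV-scatter-∌ y {l} l∉W = trans (lookupV-tabulate _ l)
    (xorSum-zero (allFinL card) (λ a → cong (_∧ lookupV y a) (δ-≢ (∌⇒≢ {W = W} l∉W (e-∈ a)))))

  gather-scatter : ∀ y → gather (scatter y) ≡ y
  gather-scatter y = lookupV-injective (λ a → trans (lookupV-tabulate _ a) (lookupV-scatter-e y a))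

  scatter-gather : ∀ x → (∀ l → x ∋ l → W ∋ l) → scatter (gather x) ≡ x
  scatter-gather x support = lookupV-injective λ l → begin
    lookupV (scatter (gather x)) l
      ≡⟨ lookupV-tabulate _ l ⟩
    xorSum (allFinL card) (λ a → δ (e a) l ∧ lookupV (gather x) a)
      ≡⟨ xorSum-cong (allFinL card) (λ a → cong (δ (e a) l ∧_) (lookupV-tabulate _ a)) ⟩
    xorSum (allFinL card) (λ a → δ (e a) l ∧ lookupV x (e a))
      ≡⟨ xorSum-∘e (λ l′ → δ l′ l ∧ lookupV x l′) ⟩
    xorSum (allFinL n) (λ l′ → lookupV W l′ ∧ (δ l′ l ∧ lookupV x l′))
      ≡⟨ xorSum-cong (allFinL n) (λ l′ → within-W x support l′ (δ l′ l)) ⟩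
    xorSum (allFinL n) (λ l′ → δ l′ l ∧ lookupV x l′)
      ≡⟨ xorSum-cong (allFinL n) (entry l) ⟩
    xorSum (allFinL n) (λ l′ → δ l′ l ∧ lookupV x l)
      ≡⟨ xorSum-δ l (lookupV x l) ⟩
    lookupV x l
      ∎
    where
    open ≡-Reasoning
    entry : ∀ l l′ → δ l′ l ∧ lookupV x l′ ≡ δ l′ l ∧ lookupV x l
    entry l l′ with l′ FinP.≟ l
    ... | yes refl = refl
    ... | no _     = refl

  bijection : SubsetBijection (λ y → inKernel N y ≡ true) (IsKernelOn M W)
  bijection = record
    { to = scatter ; from = gather ; to-∈ = λ {y} → scatter-∈ {y} ; from-∈ = gather-∈
    ; from∘to = λ {y} _ → gather-scatter y ; to∘from = λ {x} k → scatter-gather x (IsKernelOn.support k) }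
    where
    scatter-support : ∀ y l → scatter y ∋ l → W ∋ l
    scatter-support y l yl with lookupV W l in l∈W
    ... | true  = refl
    ... | false with () ← trans (sym yl) (lookupV-scatter-∌ y l∈W)
    scatter-∈ : ∀ {y} → inKernel N y ≡ true → IsKernelOn M W (scatter y)
    scatter-∈ {y} ker = record { support = scatter-support y ; annihilated = ann }
      where
      ann : ∀ l → W ∋ l → mulRow M (scatter y) l ≡ false
      ann l l∈W with e-onto l l∈W
      ... | a , refl = trans (sym (mulRow-gather (scatter y) (scatter-support y) a))
                             (trans (cong (λ z → mulRow N z a) (gather-scatter y)) (inKernel⁻ N y ker a))
    gather-∈ : ∀ {x} → IsKernelOn M W x → inKernel N (gather x) ≡ true
    gather-∈ {x} k = foldr-∧-true⁺ (not ∘ mulRow N (gather x)) (allFinL card)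
      (λ a → cong not (trans (mulRow-gather x support a) (annihilated (e a) (e-∈ a))))
      where
      open IsKernelOn k

kernelSize-induced : (G : Graph n) (W : Vec Bool n) → kernelSize (inducedAdj G W) ≡ kernelSizeOn (adj G) W
kernelSize-induced G W = count-cong (λ y → inKernel (inducedAdj G W) y Bool.≟ true) (isKernelOn? (adj G) W)
                                    (InducedSubgraph.bijection (adj G) W)

nullityOn : Graph n → Vec Bool n → ℕ
nullityOn G W = ⌊log₂ kernelSizeOn (adj G) W ⌋

kernelSizeOn≡2^nullityOn : (G : Graph n) (W : Vec Bool n) → kernelSizeOn (adj G) W ≡ 2 ^ nullityOn G W
kernelSizeOn≡2^nullityOn G W with k , K≡2^k , _ ← kernelSizeOn-powerOfTwo G W =
  trans K≡2^k (cong (2 ^_) (sym (trans (cong ⌊log₂_⌋ K≡2^k) (⌊log₂[2^n]⌋≡n k))))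

isOdd-nullityOn : (G : Graph n) (W : Vec Bool n) → isOdd (nullityOn G W) ≡ parity W
isOdd-nullityOn G W with k , K≡2^k , odd ← kernelSizeOn-powerOfTwo G W =
  trans (cong isOdd (trans (cong ⌊log₂_⌋ K≡2^k) (⌊log₂[2^n]⌋≡n k))) odd

nullityOn-double : ∀ {m} (G : Graph n) (W : Vec Bool n) (H : Graph m) (U : Vec Bool m) →
                   kernelSizeOn (adj G) W ≡ 2 * kernelSizeOn (adj H) U → nullityOn G W ≡ suc (nullityOn H U)
nullityOn-double G W H U K≡2K = trans (cong ⌊log₂_⌋ (trans K≡2K (cong (2 *_) (kernelSizeOn≡2^nullityOn H U))))
                                      (⌊log₂[2^n]⌋≡n (suc (nullityOn H U)))

nullityInduced≡nullityOn : (G : Graph n) (W : Vec Bool n) → nullityInduced G W ≡ nullityOn G W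
nullityInduced≡nullityOn G W = cong ⌊log₂_⌋ (kernelSize-induced G W)


-- Relabelling vertices

xorSum-↭ : {js ks : List (Fin n)} → js ↭ ks → (f : Fin n → Bool) → xorSum js f ≡ xorSum ks f
xorSum-↭ Perm.refl          f = refl
xorSum-↭ (Perm.prep j p)    f = cong (f j xor_) (xorSum-↭ p f)
xorSum-↭ (Perm.swap j k p)  f =
  trans (cong (λ s → f j xor (f k xor s)) (xorSum-↭ p f)) (Xor.x∙yz≈y∙xz (f j) (f k) _)
xorSum-↭ (Perm.trans p q)   f = trans (xorSum-↭ p f) (xorSum-↭ q f)

module Relabel (σ : Fin n ↔ Fin n) where
  open Inverse σ renaming (to to σ→; from to σ←)

  xorSum-permute : (f : Fin n → Bool) → xorSum (allFinL n) (f ∘ σ→) ≡ xorSum (allFinL n) f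
  xorSum-permute f = trans (sym (xorSum-map σ→ (allFinL n) f))
    (xorSum-↭ (map-bijection-↭ (allFinL-unique n) ∈-allFinL σ→ σ← strictlyInverseˡ strictlyInverseʳ) f)

  image preimage : Vec Bool n → Vec Bool n
  image W    = tabulate (lookupV W ∘ σ←)
  preimage W = tabulate (lookupV W ∘ σ→)

  lookupV-image : ∀ W i → lookupV (image W) (σ→ i) ≡ lookupV W i
  lookupV-image W i = trans (lookupV-tabulate _ (σ→ i)) (cong (lookupV W) (strictlyInverseʳ i))

  image-preimage : ∀ W → image (preimage W) ≡ W
  image-preimage W = lookupV-injective λ i →
    trans (lookupV-tabulate _ i) (trans (lookupV-tabulate _ (σ← i)) (cong (lookupV W) (strictlyInverseˡ i)))

  preimage-image : ∀ W → preimage (image W) ≡ W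
  preimage-image W = lookupV-injective λ i → trans (lookupV-tabulate _ i) (lookupV-image W i)

  module _ (M M′ : Matrix n) (relabels : ∀ i j → M (σ→ i) (σ→ j) ≡ M′ i j) where

    mulRow-preimage : ∀ y i → mulRow M′ (preimage y) i ≡ mulRow M y (σ→ i)
    mulRow-preimage y i = trans (xorSum-cong (allFinL n) entry) (xorSum-permute (λ j → M (σ→ i) j ∧ lookupV y j))
      where
      entry : ∀ j → M′ i j ∧ lookupV (preimage y) j ≡ M (σ→ i) (σ→ j) ∧ lookupV y (σ→ j)
      entry j = cong₂ _∧_ (sym (relabels i j)) (lookupV-tabulate _ j)

    preimage-∈ : ∀ {W y} → IsKernelOn M (image W) y → IsKernelOn M′ W (preimage y)
    preimage-∈ {W} {y} k = record
      { support     = λ i yi →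
          trans (sym (lookupV-image W i)) (support (σ→ i) (trans (sym (lookupV-tabulate _ i)) yi))
      ; annihilated = λ i i∈W → trans (mulRow-preimage y i) (annihilated (σ→ i) (trans (lookupV-image W i) i∈W)) }
      where open IsKernelOn k

    image-∈ : ∀ {W x} → IsKernelOn M′ W x → IsKernelOn M (image W) (image x)
    image-∈ {W} {x} k = record
      { support     = λ i xi →
          trans (lookupV-tabulate _ i) (support (σ← i) (trans (sym (lookupV-tabulate _ i)) xi))
      ; annihilated = λ i i∈W → begin
          mulRow M (image x) i                   ≡⟨ cong (mulRow M (image x)) (strictlyInverseˡ i) ⟨
          mulRow M (image x) (σ→ (σ← i))         ≡⟨ mulRow-preimage (image x) (σ← i) ⟨
          mulRow M′ (preimage (image x)) (σ← i)  ≡⟨ cong (λ z → mulRow M′ z (σ← i)) (preimage-image x) ⟩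
          mulRow M′ x (σ← i)                     ≡⟨ annihilated (σ← i) (trans (sym (lookupV-tabulate _ i)) i∈W) ⟩
          false                                  ∎ }
      where
      open IsKernelOn k
      open ≡-Reasoning

    kernelSizeOn-relabel : ∀ W → kernelSizeOn M (image W) ≡ kernelSizeOn M′ W
    kernelSizeOn-relabel W = count-cong (isKernelOn? M (image W)) (isKernelOn? M′ W) (record
      { to = preimage ; from = image ; to-∈ = preimage-∈ ; from-∈ = image-∈
      ; from∘to = λ {y} _ → image-preimage y ; to∘from = λ {x} _ → preimage-image x })


-- Sums over vertex subsets

sumℤ : List ℤ → ℤ
sumℤ = foldr ℤ._+_ (+ 0)

sumVecs : (n : ℕ) → (Vec Bool n → ℤ) → ℤ
sumVecs n F = sumℤ (map F (allVecs n))

sumℤ-↭ : {xs ys : List ℤ} → xs ↭ ys → sumℤ xs ≡ sumℤ ys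
sumℤ-↭ xs↭ys = PermₛP.foldr-commMonoid (setoid ℤ) ℤP.+-0-isCommutativeMonoid (↭⇒↭ₛ xs↭ys)

sumVecs-reindex : (σ τ : Vec Bool n → Vec Bool n) → (∀ x → σ (τ x) ≡ x) → (∀ x → τ (σ x) ≡ x) →
                  (F : Vec Bool n → ℤ) → sumVecs n (F ∘ σ) ≡ sumVecs n F
sumVecs-reindex {n} σ τ στ τσ F = begin
  sumℤ (map (F ∘ σ) (allVecs n))
    ≡⟨ cong sumℤ (ListP.map-∘ (allVecs n)) ⟩
  sumℤ (map F (map σ (allVecs n)))
    ≡⟨ sumℤ-↭ (PermP.map⁺ F (map-bijection-↭ (allVecs-unique n) ∈-allVecs σ τ στ τσ)) ⟩
  sumℤ (map F (allVecs n))
    ∎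
  where open ≡-Reasoning

module ℤSemigroup = CommSemigroupProperties ℤP.+-commutativeSemigroup

sumℤ-++ : (xs ys : List ℤ) → sumℤ (xs ++ ys) ≡ sumℤ xs ℤ.+ sumℤ ys
sumℤ-++ []       ys = sym (ℤP.+-identityˡ (sumℤ ys))
sumℤ-++ (x ∷ xs) ys = trans (cong (ℤ._+_ x) (sumℤ-++ xs ys)) (sym (ℤP.+-assoc x (sumℤ xs) (sumℤ ys)))

sumℤ-map-+ : (F G : A → ℤ) (xs : List A) →
             sumℤ (map (λ a → F a ℤ.+ G a) xs) ≡ sumℤ (map F xs) ℤ.+ sumℤ (map G xs)
sumℤ-map-+ F G []       = refl
sumℤ-map-+ F G (x ∷ xs) =
  trans (cong (ℤ._+_ (F x ℤ.+ G x)) (sumℤ-map-+ F G xs)) (ℤSemigroup.interchange (F x) (G x) _ _)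

sumℤ-map-neg : (F : A → ℤ) (xs : List A) → sumℤ (map (ℤ.-_ ∘ F) xs) ≡ ℤ.- sumℤ (map F xs)
sumℤ-map-neg F []       = refl
sumℤ-map-neg F (x ∷ xs) =
  trans (cong (ℤ._+_ (ℤ.- F x)) (sumℤ-map-neg F xs)) (sym (ℤP.neg-distrib-+ (F x) (sumℤ (map F xs))))

sumVecs-cong : {F G : Vec Bool n → ℤ} → (∀ W → F W ≡ G W) → sumVecs n F ≡ sumVecs n G
sumVecs-cong {n} F≗G = cong sumℤ (ListP.map-cong F≗G (allVecs n))

sumVecs-+ : (F G : Vec Bool n → ℤ) → sumVecs n (λ W → F W ℤ.+ G W) ≡ sumVecs n F ℤ.+ sumVecs n G
sumVecs-+ {n} F G = sumℤ-map-+ F G (allVecs n)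

sumVecs-neg : (F : Vec Bool n → ℤ) → sumVecs n (ℤ.-_ ∘ F) ≡ ℤ.- sumVecs n F
sumVecs-neg {n} F = sumℤ-map-neg F (allVecs n)

sumVecs-∷ : (F : Vec Bool (suc n) → ℤ) →
            sumVecs (suc n) F ≡ sumVecs n (F ∘ (false ∷_)) ℤ.+ sumVecs n (F ∘ (true ∷_))
sumVecs-∷ {n} F = begin
  sumℤ (map F (map (false ∷_) (allVecs n) ++ map (true ∷_) (allVecs n)))
    ≡⟨ cong sumℤ (ListP.map-++ F (map (false ∷_) (allVecs n)) _) ⟩
  sumℤ (map F (map (false ∷_) (allVecs n)) ++ map F (map (true ∷_) (allVecs n)))
    ≡⟨ sumℤ-++ (map F (map (false ∷_) (allVecs n))) _ ⟩
  sumℤ (map F (map (false ∷_) (allVecs n))) ℤ.+ sumℤ (map F (map (true ∷_) (allVecs n)))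
    ≡⟨ cong₂ (λ xs ys → sumℤ xs ℤ.+ sumℤ ys) (ListP.map-∘ (allVecs n)) (ListP.map-∘ (allVecs n)) ⟨
  sumVecs n (F ∘ (false ∷_)) ℤ.+ sumVecs n (F ∘ (true ∷_))
    ∎
  where open ≡-Reasoning


when : Bool → ℤ → ℤ
when b z = if b then z else + 0

when-+ : ∀ b x y → when b (x ℤ.+ y) ≡ when b x ℤ.+ when b y
when-+ true  x y = refl
when-+ false x y = refl

when-neg : ∀ b x → when b (ℤ.- x) ≡ ℤ.- when b x
when-neg true  x = refl
when-neg false x = refl

when-split : ∀ b z → when b z ℤ.+ when (not b) z ≡ z
when-split true  z = ℤP.+-identityʳ z
when-split false z = ℤP.+-identityˡ z

sumVecs-toggle : (v : Fin n) (F : Vec Bool n → ℤ) → sumVecs n (λ W → F (toggle W v)) ≡ sumVecs n F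
sumVecs-toggle v = sumVecs-reindex (λ W → toggle W v) (λ W → toggle W v) involutive involutive
  where involutive = λ W → addAt-involutive W v true

-- c = true keeps the representatives W ∌ v of the pairs {W, W △ {v}}, c = false those W ∋ v.
sumVecs-pairs : (c : Bool) (v : Fin n) (F : Vec Bool n → ℤ) →
                sumVecs n F ≡ sumVecs n (λ W → when (c xor lookupV W v) (F W ℤ.+ F (toggle W v)))
sumVecs-pairs {n} c v F = begin
  sumVecs n F
    ≡⟨ sumVecs-cong (λ W → when-split (side W) (F W)) ⟨
  sumVecs n (λ W → when (side W) (F W) ℤ.+ when (not (side W)) (F W))
    ≡⟨ sumVecs-+ (λ W → when (side W) (F W)) _ ⟩
  kept ℤ.+ sumVecs n (λ W → when (not (side W)) (F W))
    ≡⟨ cong (ℤ._+_ kept) (sumVecs-toggle v (λ W → when (not (side W)) (F W))) ⟨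
  kept ℤ.+ sumVecs n (λ W → when (not (side (toggle W v))) (F (toggle W v)))
    ≡⟨ cong (ℤ._+_ kept) (sumVecs-cong (λ W → cong (λ b → when b (F (toggle W v))) (other-side W))) ⟩
  kept ℤ.+ sumVecs n (λ W → when (side W) (F (toggle W v)))
    ≡⟨ sumVecs-+ (λ W → when (side W) (F W)) _ ⟨
  sumVecs n (λ W → when (side W) (F W) ℤ.+ when (side W) (F (toggle W v)))
    ≡⟨ sumVecs-cong (λ W → when-+ (side W) (F W) (F (toggle W v))) ⟨
  sumVecs n (λ W → when (side W) (F W ℤ.+ F (toggle W v)))
    ∎
  where
  open ≡-Reasoning
  side : Vec Bool n → Bool
  side W = c xor lookupV W v
  kept = sumVecs n (λ W → when (side W) (F W))
  other-side : ∀ W → not (side (toggle W v)) ≡ side W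
  other-side W = begin
    not (c xor lookupV (toggle W v) v)   ≡⟨ cong (λ b → not (c xor b)) (lookupV-toggle-≡ W v) ⟩
    not (c xor not (lookupV W v))        ≡⟨ cong not (BoolP.not-distribʳ-xor c (lookupV W v)) ⟨
    not (not (c xor lookupV W v))        ≡⟨ BoolP.not-involutive (c xor lookupV W v) ⟩
    c xor lookupV W v                    ∎

sign : Bool → ℤ
sign false = + 1
sign true  = -[1+ 0 ]

sign-not : ∀ b → sign (not b) ≡ ℤ.- sign b
sign-not false = refl
sign-not true  = refl

≡-self-neg : ∀ {x} → x ≡ ℤ.- x → x ≡ + 0
≡-self-neg {+ zero} _ = refl

-- Toggling a vertex u ≠ v flips the sign (-1)^|W| but keeps the membership of v.
sumVecs-sign-vanishes : {u v : Fin n} → u ≢ v → (c : Bool) →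
                        sumVecs n (λ W → when (c xor lookupV W v) (sign (parity W))) ≡ + 0
sumVecs-sign-vanishes {n} {u} {v} u≢v c = ≡-self-neg (begin
  sumVecs n g                        ≡⟨ sumVecs-toggle u g ⟨
  sumVecs n (λ W → g (toggle W u))   ≡⟨ sumVecs-cong flips ⟩
  sumVecs n (ℤ.-_ ∘ g)               ≡⟨ sumVecs-neg g ⟩
  ℤ.- sumVecs n g                    ∎)
  where
  open ≡-Reasoning
  g : Vec Bool n → ℤ
  g W = when (c xor lookupV W v) (sign (parity W))
  flips : ∀ W → g (toggle W u) ≡ ℤ.- g W
  flips W = begin
    when (c xor lookupV (toggle W u) v) (sign (parity (toggle W u)))
      ≡⟨ cong₂ (λ b p → when (c xor b) (sign p)) (lookupV-toggle-≢ W u≢v) (parity-toggle W u) ⟩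
    when (c xor lookupV W v) (sign (not (parity W)))
      ≡⟨ cong (when (c xor lookupV W v)) (sign-not (parity W)) ⟩
    when (c xor lookupV W v) (ℤ.- sign (parity W))
      ≡⟨ when-neg (c xor lookupV W v) _ ⟩
    ℤ.- g W
      ∎


-- Coefficients of (x - 1)ᵏ

coeff-⊕ : ∀ p q k → coeff (p ⊕ q) k ≡ coeff p k ℤ.+ coeff q k
coeff-⊕ []      q       k       = sym (ℤP.+-identityˡ (coeff q k))
coeff-⊕ (a ∷ p) []      zero    = sym (ℤP.+-identityʳ a)
coeff-⊕ (a ∷ p) []      (suc k) = sym (ℤP.+-identityʳ (coeff p k))
coeff-⊕ (a ∷ p) (b ∷ q) zero    = refl
coeff-⊕ (a ∷ p) (b ∷ q) (suc k) = coeff-⊕ p q k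

coeff-scale : ∀ c p k → coeff (scale c p) k ≡ c ℤ.* coeff p k
coeff-scale c []      k       = sym (ℤP.*-zeroʳ c)
coeff-scale c (a ∷ p) zero    = refl
coeff-scale c (a ∷ p) (suc k) = coeff-scale c p k

coeff-foldr-⊕ : (p : A → Poly) (xs : List A) (k : ℕ) →
                coeff (foldr (λ a acc → p a ⊕ acc) [] xs) k ≡ sumℤ (map (λ a → coeff (p a) k) xs)
coeff-foldr-⊕ p []       k = refl
coeff-foldr-⊕ p (x ∷ xs) k =
  trans (coeff-⊕ (p x) _ k) (cong (ℤ._+_ (coeff (p x) k)) (coeff-foldr-⊕ p xs k))

c₀ c₁ : ℕ → ℤ
c₀ k = coeff (xMinus1 ^ᴾ k) 0
c₁ k = coeff (xMinus1 ^ᴾ k) 1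

c₀≡sign : ∀ k → c₀ k ≡ sign (isOdd k)
c₀≡sign zero    = refl
c₀≡sign (suc k) = begin
  coeff (xMinus1 ⊗ (xMinus1 ^ᴾ k)) 0               ≡⟨ coeff-⊕ (scale -[1+ 0 ] (xMinus1 ^ᴾ k)) _ 0 ⟩
  coeff (scale -[1+ 0 ] (xMinus1 ^ᴾ k)) 0 ℤ.+ + 0  ≡⟨ ℤP.+-identityʳ _ ⟩
  coeff (scale -[1+ 0 ] (xMinus1 ^ᴾ k)) 0          ≡⟨ coeff-scale -[1+ 0 ] (xMinus1 ^ᴾ k) 0 ⟩
  -[1+ 0 ] ℤ.* c₀ k                                ≡⟨ ℤP.-1*i≡-i (c₀ k) ⟩
  ℤ.- c₀ k                                         ≡⟨ cong ℤ.-_ (c₀≡sign k) ⟩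
  ℤ.- sign (isOdd k)                               ≡⟨ sign-not (isOdd k) ⟨
  sign (isOdd (suc k))                             ∎
  where open ≡-Reasoning

-- [x¹] (x - 1)ᵏ⁺¹ = - [x¹] (x - 1)ᵏ + [x⁰] (x - 1)ᵏ
c₁+c₁≡c₀ : ∀ k → c₁ k ℤ.+ c₁ (suc k) ≡ c₀ k
c₁+c₁≡c₀ k = begin
  c₁ k ℤ.+ coeff (xMinus1 ⊗ p) 1
    ≡⟨ cong (ℤ._+_ (c₁ k)) (coeff-⊕ (scale -[1+ 0 ] p) _ 1) ⟩
  c₁ k ℤ.+ (coeff (scale -[1+ 0 ] p) 1 ℤ.+ coeff (scale (+ 1) p ⊕ (+ 0 ∷ [])) 0)
    ≡⟨ cong₂ (λ u v → c₁ k ℤ.+ (u ℤ.+ v)) linear constant ⟩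
  c₁ k ℤ.+ (ℤ.- c₁ k ℤ.+ c₀ k)
    ≡⟨ ℤP.+-assoc (c₁ k) (ℤ.- c₁ k) (c₀ k) ⟨
  (c₁ k ℤ.+ ℤ.- c₁ k) ℤ.+ c₀ k
    ≡⟨ cong (ℤ._+ c₀ k) (ℤP.+-inverseʳ (c₁ k)) ⟩
  + 0 ℤ.+ c₀ k
    ≡⟨ ℤP.+-identityˡ (c₀ k) ⟩
  c₀ k
    ∎
  where
  open ≡-Reasoning
  p = xMinus1 ^ᴾ k
  linear : coeff (scale -[1+ 0 ] p) 1 ≡ ℤ.- c₁ k
  linear = trans (coeff-scale -[1+ 0 ] p 1) (ℤP.-1*i≡-i (c₁ k))
  constant : coeff (scale (+ 1) p ⊕ (+ 0 ∷ [])) 0 ≡ c₀ k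
  constant = trans (coeff-⊕ (scale (+ 1) p) _ 0)
                   (trans (ℤP.+-identityʳ _) (trans (coeff-scale (+ 1) p 0) (ℤP.*-identityˡ (c₀ k))))


-- γ along a construction sequence

Γ : Graph n → ℤ
Γ {n} G = sumVecs n (λ W → c₁ (nullityOn G W))

γ≡Γ : (G : Graph n) → γ G ≡ Γ G
γ≡Γ {n} G = trans (coeff-foldr-⊕ (λ W → xMinus1 ^ᴾ nullityInduced G W) (allVecs n) 1)
                  (sumVecs-cong (cong c₁ ∘ nullityInduced≡nullityOn G))

Γ-≅ : (G H : Graph n) → G ≅ H → Γ G ≡ Γ H
Γ-≅ {n} G H (σ , relabels) = begin
  Γ G
    ≡⟨ sumVecs-reindex image preimage image-preimage preimage-image _ ⟨
  sumVecs n (λ W → c₁ (nullityOn G (image W)))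
    ≡⟨ sumVecs-cong (cong (c₁ ∘ ⌊log₂_⌋) ∘ kernelSizeOn-relabel (adj G) (adj H) relabels) ⟩
  Γ H
    ∎
  where
  open ≡-Reasoning
  open Relabel σ

Γ-extend : (G : Graph n) (N : Fin n → Bool) →
           Γ (extend G N) ≡ Γ G ℤ.+ sumVecs n (λ W → c₁ (nullityOn (extend G N) (true ∷ W)))
Γ-extend {n} G N = trans (sumVecs-∷ (c₁ ∘ nullityOn (extend G N)))
  (cong (ℤ._+ sumVecs n (λ W → c₁ (nullityOn (extend G N) (true ∷ W))))
        (sumVecs-cong (λ W → cong (c₁ ∘ ⌊log₂_⌋) (kernelSizeOn-false∷ (adj (extend G N)) W))))

Γ-trueTwin : (G : Graph n) (v : Fin n) → Γ (extend G (trueTwinN G v)) ≡ Γ G ℤ.+ Γ G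
Γ-trueTwin {n} G v = trans (Γ-extend G (trueTwinN G v)) (cong (ℤ._+_ (Γ G)) (begin
  sumVecs n (λ W → c₁ (nullityOn (extend G (trueTwinN G v)) (true ∷ W)))
    ≡⟨ sumVecs-cong (λ W → cong (c₁ ∘ ⌊log₂_⌋) (kernelSizeOn-trueTwin G v W)) ⟩
  sumVecs n (λ W → c₁ (nullityOn G (toggle W v)))
    ≡⟨ sumVecs-toggle v (c₁ ∘ nullityOn G) ⟩
  Γ G
    ∎))
  where open ≡-Reasoning

pair≡sign : (G : Graph n) (W : Vec Bool n) {a b : ℕ} → a ≡ suc (nullityOn G W) → b ≡ nullityOn G W →
            c₁ a ℤ.+ c₁ b ≡ sign (parity W)
pair≡sign G W refl refl = begin
  c₁ (suc ν) ℤ.+ c₁ ν   ≡⟨ ℤP.+-comm (c₁ (suc ν)) (c₁ ν) ⟩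
  c₁ ν ℤ.+ c₁ (suc ν)   ≡⟨ c₁+c₁≡c₀ ν ⟩
  c₀ ν                  ≡⟨ c₀≡sign ν ⟩
  sign (isOdd ν)        ≡⟨ cong sign (isOdd-nullityOn G W) ⟩
  sign (parity W)       ∎
  where
  open ≡-Reasoning
  ν = nullityOn G W

Γ-extend-paired : (G : Graph n) (N : Fin n → Bool) (c : Bool) (v : Fin n) →
                  (∀ W → c xor lookupV W v ≡ true →
                     nullityOn (extend G N) (true ∷ W) ≡ suc (nullityOn G W) ×
                     nullityOn (extend G N) (true ∷ toggle W v) ≡ nullityOn G W) →
                  Γ (extend G N) ≡ Γ G ℤ.+ sumVecs n (λ W → when (c xor lookupV W v) (sign (parity W)))
Γ-extend-paired {n} G N c v recurrences = trans (Γ-extend G N) (cong (ℤ._+_ (Γ G))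
  (trans (sumVecs-pairs c v (λ W → c₁ (nullityOn E (true ∷ W)))) (sumVecs-cong paired)))
  where
  E = extend G N
  paired : ∀ W → when (c xor lookupV W v) (c₁ (nullityOn E (true ∷ W)) ℤ.+ c₁ (nullityOn E (true ∷ toggle W v))) ≡
                 when (c xor lookupV W v) (sign (parity W))
  paired W with c xor lookupV W v in side
  ... | true  = pair≡sign G W (proj₁ (recurrences W side)) (proj₂ (recurrences W side))
  ... | false = refl

Γ-pendant : (G : Graph n) (v : Fin n) →
            Γ (extend G (pendantN v)) ≡ Γ G ℤ.+ sumVecs n (λ W → when (not (lookupV W v)) (sign (parity W)))
Γ-pendant G v = Γ-extend-paired G (pendantN v) true v recurrences
  where
  E = extend G (pendantN v)
  recurrences : ∀ W → not (lookupV W v) ≡ true → _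
  recurrences W v∉W = nullityOn-double E (true ∷ W) G W (kernelSizeOn-pendant-∌ G v W v∉W′)
                    , cong ⌊log₂_⌋ (trans (kernelSizeOn-pendant-∋ G v (toggle W v) (toggle-∋ W v∉W′))
                                          (cong (kernelSizeOn (adj G)) (addAt-involutive W v true)))
    where v∉W′ = BoolP.not-injective v∉W

Γ-falseTwin : (G : Graph n) (v : Fin n) →
              Γ (extend G (falseTwinN G v)) ≡ Γ G ℤ.+ sumVecs n (λ W → when (lookupV W v) (sign (parity W)))
Γ-falseTwin G v = Γ-extend-paired G (falseTwinN G v) false v recurrences
  where
  E = extend G (falseTwinN G v)
  recurrences : ∀ W → lookupV W v ≡ true → _
  recurrences W v∈W = nullityOn-double E (true ∷ W) G W (kernelSizeOn-falseTwin-∋ G v W v∈W)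
                    , cong ⌊log₂_⌋ (trans (kernelSizeOn-falseTwin-∌ G v (toggle W v) (toggle-∌ W v∈W))
                                          (cong (kernelSizeOn (adj G)) (addAt-involutive W v true)))

nonIsolated⇒2≤n : (G : Graph n) (v : Fin n) → NonIsolated G v → 2 ≤ n
nonIsolated⇒2≤n {suc zero}    G zero (zero , v~v) with () ← trans (sym v~v) (Graph.irrefl G zero)
nonIsolated⇒2≤n {suc (suc n)} G v    _           = s≤s (s≤s z≤n)

other-vertex : 2 ≤ n → (v : Fin n) → ∃ λ u → u ≢ v
other-vertex (s≤s (s≤s z≤n)) zero    = suc zero , λ ()
other-vertex (s≤s (s≤s z≤n)) (suc v) = zero , λ ()

+-vanishing : ∀ {a b c : ℤ} → a ≡ c → b ≡ + 0 → a ℤ.+ b ≡ c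
+-vanishing refl refl = ℤP.+-identityʳ _

Γ-construction : ∀ {H : Graph n} {t} → DHSeq n H t → 2 ≤ n → Γ H ≡ + (2 ^ (t + 1))
Γ-construction single (s≤s ())
Γ-construction {suc (suc zero)} (pendant single zero) _ = refl
Γ-construction {suc (suc zero)} (pendant (pendant _ ()) _) _
Γ-construction {suc (suc zero)} (pendant (trueTwin _ () _) _) _
Γ-construction {suc (suc zero)} (pendant (falseTwin _ () _) _) _
Γ-construction {suc (suc (suc n))} (pendant {G = G} s v) _ =
  trans (Γ-pendant G v) (+-vanishing (Γ-construction s 2≤n) (sumVecs-sign-vanishes (proj₂ (other-vertex 2≤n v)) true))
  where
  2≤n : 2 ≤ suc (suc n)
  2≤n = s≤s (s≤s z≤n)
Γ-construction (falseTwin {G = G} s v v~) _ =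
  trans (Γ-falseTwin G v) (+-vanishing (Γ-construction s 2≤n) (sumVecs-sign-vanishes (proj₂ (other-vertex 2≤n v)) false))
  where 2≤n = nonIsolated⇒2≤n G v v~
Γ-construction (trueTwin {G = G} {t} s v v~) _ =
  trans (Γ-trueTwin G v) (trans (cong₂ ℤ._+_ IH IH) (cong (λ m → + (2 ^ (t + 1) + m)) (sym (ℕP.+-identityʳ _))))
  where IH = Γ-construction s (nonIsolated⇒2≤n G v v~)

theorem4p23 : ∀ {n : ℕ} (G : Graph n) → 2 ≤ n →
    ∀ {H : Graph n} {t : ℕ} → DHSeq n H t → G ≅ H →
    γ G ≡ + (2 ^ (t + 1))
theorem4p23 G 2≤n {H} {t} construction G≅H = begin
  γ G                ≡⟨ γ≡Γ G ⟩
  Γ G                ≡⟨ Γ-≅ G H G≅H ⟩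
  Γ H                ≡⟨ Γ-construction construction 2≤n ⟩
  + (2 ^ (t + 1))    ∎
  where open ≡-Reasoning
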